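{- Let $a,b$ be integers with $\gcd(a,b)=1$, let $f(x)=ax^3+b$, and let $q$ be an odd prime. Then $$a_q(f)=\begin{cases} \left(\frac{b}{q}\right) & \text{if } q\mid a,\\ 0 & \text{if } q\nmid a \text{ and } (q\mid b \text{ or } q=3 \text{ or } q\equiv 2\bmod 3),\\ \dfrac{\left(\frac{b}{q}\right)(1+\phi_{q,3}(\bar a^2\bar b))}{q-3} & \text{if } q\nmid ab,\ q\equiv 1\bmod 3,\ a^2b \text{ is a cubic residue mod } q,\\ \dfrac{\left(\frac{b}{q}\right)(1+\phi_{q,3}(\bar a^2\bar b))}{q} & \text{if } q\nmid ab,\ q\equiv 1\bmod 3,\ a^2b \text{ is a cubic non-residue mod } q.\end{cases}$$
   Context: For an odd square-free positive integer $d$ and a polynomial $f$, $a_d(f)=\dfrac{\sum_{r \bmod d}\left(\frac{f(r)}{d}\right)}{\#\{r\bmod d : \gcd(f(r),d)=1\}}$, where $\left(\frac{\cdot}{d}\right)$ is the Jacobi symbol (the Legendre symbol when $d=q$ is prime). $\bar a,\bar b$ are inverses modulo $q$. For a prime $q\equiv 1\bmod 3$ and integer $E$, $\phi_{q,3}(E)=\sum_{u=1}^{q-1}\left(\frac{u}{q}\right)\left(\frac{u^3+E}{q}\right)$. A cubic residue mod $q$ is an integer prime to $q$ congruent to a cube modulo $q$. -}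

module Defs where

open import Data.Nat as ℕ using (ℕ; zero; suc; _%_)
open import Data.Integer as ℤ using (ℤ; +_; _+_; _*_; _-_; _≟_)
open import Data.Integer.DivMod using (_%ℕ_)
open import Data.Integer.GCD using (gcd)
open import Data.Integer.Divisibility using (_∣_)
open import Data.Fin using (Fin; toℕ)
open import Data.Fin.Properties using (any?)
open import Data.List using (List; map; foldr; filter; length; upTo)
open import Data.Product using (∃; _×_)
open import Data.Rational as ℚ using (ℚ; 0ℚ; _/_)
open import Relation.Nullary using (¬_; yes; no)
open import Relation.Binary.PropositionalEquality using (_≡_)

infix 4 _≡ᶻ_[mod_]
_≡ᶻ_[mod_] : ℤ → ℤ → ℕ → Set
m ≡ᶻ n [mod q ] = (+ q) ∣ (m - n)

legendre : ℤ → ℕ → ℤ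
legendre n zero = + 0
legendre n (suc k) with n %ℕ (suc k)
... | zero = + 0
... | suc j with any? (λ (r : Fin (suc k)) → ((toℕ r ℕ.* toℕ r) % suc k) ℕ.≟ suc j)
...   | yes _ = + 1
...   | no _ = ℤ.-[1+ 0 ]

sumℤ : List ℤ → ℤ
sumℤ = foldr _+_ (+ 0)

-- Division of an integer by a natural number as a rational
-- (total: returns 0 when the denominator is 0, which never occurs in the lemma).
divℚ : ℤ → ℕ → ℚ
divℚ n zero = 0ℚ
divℚ n (suc m) = n / suc m

-- a_q(f) for q prime: (Σ_{r mod q} (f(r)/q)) / #{r mod q : gcd(f(r),q) = 1},
-- with residues r represented by 0, 1, …, q-1.
aq : (ℤ → ℤ) → ℕ → ℚ
aq f q = divℚ (sumℤ (map (λ r → legendre (f (+ r)) q) (upTo q)))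
              (length (filter (λ r → gcd (f (+ r)) (+ q) ≟ + 1) (upTo q)))

cubicPoly : ℤ → ℤ → ℤ → ℤ
cubicPoly a b x = a * (x * x * x) + b

phi3 : ℕ → ℤ → ℤ
phi3 q E = sumℤ (map (λ u → legendre (+ suc u) q * legendre (+ suc u * + suc u * + suc u + E) q)
                     (upTo (q ℕ.∸ 1)))

CubicResidue : ℤ → ℕ → Set
CubicResidue n q = gcd n (+ q) ≡ + 1 × ∃ λ (x : ℤ) → (x * x * x) ≡ᶻ n [mod q ]

-- If q ∣ a then f ≡ b.  If q ∣ b, or if
--     cubing is a bijection (q = 3 or q ≡ 2 mod 3), the character sum vanishes.
--     If q ∤ ab, the substitution u = (a r)⁻¹ turns it into (b/q)(1 + φ_{q,3}(ā² b̄)),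
--     while f has three roots or none according as a² b is a cube mod q.
module Submission where

open import Defs
open import Algebra.Bundles using (CommutativeMonoid)
open import Data.Empty using (⊥; ⊥-elim)
open import Data.Fin as Fin using (Fin; toℕ; fromℕ<; punchOut)
import Data.Fin.Properties as FinP
open import Data.Fin.Permutation using (Permutation; permutation)
open import Data.Integer as ℤ using (ℤ; +_; _+_; _*_; _-_; -_; ∣_∣; _^_)
open import Data.Integer.DivMod using (_%ℕ_; _/ℕ_; a≡a%ℕn+[a/ℕn]*n; n%ℕd<d)
open import Data.Integer.Divisibility using (_∣_)
import Data.Integer.Divisibility.Signed as Signed
open import Data.Integer.GCD using (gcd; gcd[i,j]≡0⇒j≡0; gcd-zeroʳ)
import Data.Integer.Properties as ℤP
open import Data.Integer.Tactic.RingSolver using (solve-∀)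
open import Data.List using (map; applyUpTo; upTo; filter; length)
open import Data.Nat as ℕ using (ℕ; zero; suc; _%_; _∸_)
import Data.Nat.Divisibility as ℕD
import Data.Nat.DivMod as ℕDM
import Data.Nat.GCD as ℕGCD
open import Data.Nat.Primality using (Prime; euclidsLemma; prime⇒irreducible; ¬prime[0]; ¬prime[1])
import Data.Nat.Properties as ℕP
import Data.Nat.Tactic.RingSolver as ℕSolver
open import Data.Product using (∃; _×_; _,_; proj₁; proj₂)
open import Data.Rational using (ℚ; 0ℚ; _/_; ↥_; ↧_; *≡*)
import Data.Rational.Properties as ℚP
open import Data.Sum using (_⊎_; inj₁; inj₂; [_,_]′)
open import Data.Unit using (tt)
open import Data.Vec as Vec using (Vec; []; _∷_)
open import Function using (_∘_)
open import Function.Definitions using (Injective)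
open import Level using (0ℓ)
open import Relation.Nullary using (¬_; Dec; yes; no; ¬?)
open import Relation.Nullary.Decidable using (decidable-stable)
open import Relation.Binary.PropositionalEquality
  using (_≡_; _≢_; refl; sym; trans; cong; cong₂; subst; module ≡-Reasoning)

injective⇒surjective : ∀ {n} (f : Fin n → Fin n) → Injective _≡_ _≡_ f →
                       ∀ y → ∃ λ x → f x ≡ y
injective⇒surjective {suc n} f f-inj y with FinP.any? (λ x → f x Fin.≟ y)
... | yes hit = hit
... | no miss = ⊥-elim (ℕP.<-irrefl refl (FinP.injective⇒≤ g-inj))
  where
  -- Missing y, f factors through Fin n, contradicting injectivity.
  g : Fin (suc n) → Fin n
  g x = punchOut {i = y} (λ e → miss (x , sym e))
  g-inj : Injective _≡_ _≡_ g
  g-inj {i} {j} e = f-inj (FinP.punchOut-injective (λ e′ → miss (i , sym e′)) (λ e′ → miss (j , sym e′)) e)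

module RangeSum {c ℓ} (M : CommutativeMonoid c ℓ) where
  open CommutativeMonoid M using (Carrier; _≈_; _∙_; ∙-cong; reflexive)
    renaming (refl to ≈-refl; trans to ≈-trans)
  open import Algebra.Properties.CommutativeMonoid.Sum M using (sum; sum-permute; sum-cong-≗; ∑-distrib-+)

  ∑< : ℕ → (ℕ → Carrier) → Carrier
  ∑< n g = sum (λ (i : Fin n) → g (toℕ i))

  ∑<-cong : ∀ n {g g′ : ℕ → Carrier} → (∀ r → r ℕ.< n → g r ≈ g′ r) → ∑< n g ≈ ∑< n g′
  ∑<-cong zero eq = ≈-refl
  ∑<-cong (suc n) eq = ∙-cong (eq 0 (ℕ.s≤s ℕ.z≤n)) (∑<-cong n (λ r r<n → eq (suc r) (ℕ.s≤s r<n)))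

  ∑<-distrib : ∀ n (g g′ : ℕ → Carrier) → ∑< n (λ r → g r ∙ g′ r) ≈ ∑< n g ∙ ∑< n g′
  ∑<-distrib n g g′ = ∑-distrib-+ {n} (g ∘ toℕ) (g′ ∘ toℕ)

  -- A map σ sending the range {r < n} injectively into itself permutes it.
  ∑<-reindex : ∀ n (g : ℕ → Carrier) (σ : ℕ → ℕ) → (∀ r → r ℕ.< n → σ r ℕ.< n) →
               (∀ r s → r ℕ.< n → s ℕ.< n → σ r ≡ σ s → r ≡ s) → ∑< n g ≈ ∑< n (g ∘ σ)
  ∑<-reindex n g σ into inj =
    ≈-trans (sum-permute (g ∘ toℕ) π) (reflexive (sum-cong-≗ {n} λ i → cong g (FinP.toℕ-fromℕ< _)))
    where
    σ′ : Fin n → Fin n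
    σ′ i = fromℕ< (into (toℕ i) (FinP.toℕ<n i))
    σ′-inj : Injective _≡_ _≡_ σ′
    σ′-inj {i} {j} e = FinP.toℕ-injective (inj _ _ (FinP.toℕ<n i) (FinP.toℕ<n j)
      (trans (sym (FinP.toℕ-fromℕ< _)) (trans (cong toℕ e) (FinP.toℕ-fromℕ< _))))
    σ′⁻¹ : Fin n → Fin n
    σ′⁻¹ y = proj₁ (injective⇒surjective σ′ σ′-inj y)
    π : Permutation n n
    π = permutation σ′ σ′⁻¹ (λ y → proj₂ (injective⇒surjective σ′ σ′-inj y))
                            (λ x → σ′-inj (proj₂ (injective⇒surjective σ′ σ′-inj (σ′ x))))

open RangeSum ℤP.+-0-commutativeMonoid public
  using () renaming (∑< to ∑ℤ; ∑<-cong to ∑ℤ-cong; ∑<-reindex to ∑ℤ-reindex)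

sumℤ-applyUpTo : ∀ n (g : ℕ → ℤ) (f : ℕ → ℕ) → sumℤ (map g (applyUpTo f n)) ≡ ∑ℤ n (g ∘ f)
sumℤ-applyUpTo zero g f = refl
sumℤ-applyUpTo (suc n) g f = cong (λ t → g (f 0) + t) (sumℤ-applyUpTo n g (f ∘ suc))

sumℤ-upTo : ∀ n (g : ℕ → ℤ) → sumℤ (map g (upTo n)) ≡ ∑ℤ n g
sumℤ-upTo n g = sumℤ-applyUpTo n g (λ r → r)

∑ℤ-scale : ∀ n c (g : ℕ → ℤ) → ∑ℤ n (λ r → c * g r) ≡ c * ∑ℤ n g
∑ℤ-scale zero c g = sym (ℤP.*-zeroʳ c)
∑ℤ-scale (suc n) c g =
  trans (cong (λ t → c * g 0 + t) (∑ℤ-scale n c (g ∘ suc))) (sym (ℤP.*-distribˡ-+ c (g 0) _))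

∑ℤ-const : ∀ n c → ∑ℤ n (λ _ → c) ≡ + n * c
∑ℤ-const zero c = refl
∑ℤ-const (suc n) c = trans (cong (λ t → c + t) (∑ℤ-const n c)) (step (+ n) c)
  where
  step : ∀ m c → c + m * c ≡ (+ 1 + m) * c
  step = solve-∀

open RangeSum ℕP.+-0-commutativeMonoid public
  using () renaming (∑< to ∑ℕ; ∑<-cong to ∑ℕ-cong; ∑<-distrib to ∑ℕ-distrib)

𝟙 : ∀ {a} {A : Set a} → Dec A → ℕ
𝟙 (yes _) = 1
𝟙 (no _) = 0

𝟙-cong : ∀ {a b} {A : Set a} {B : Set b} → (A → B) → (B → A) → (x : Dec A) (y : Dec B) → 𝟙 x ≡ 𝟙 y
𝟙-cong to from (yes _) (yes _) = refl
𝟙-cong to from (yes a) (no ¬b) = ⊥-elim (¬b (to a))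
𝟙-cong to from (no ¬a) (yes b) = ⊥-elim (¬a (from b))
𝟙-cong to from (no _) (no _) = refl

length-filter : ∀ {p} {P : ℕ → Set p} (P? : ∀ r → Dec (P r)) n (f : ℕ → ℕ) →
                length (filter P? (applyUpTo f n)) ≡ ∑ℕ n (λ r → 𝟙 (P? (f r)))
length-filter P? zero f = refl
length-filter P? (suc n) f with P? (f 0)
... | yes _ = cong suc (length-filter P? n (f ∘ suc))
... | no _ = length-filter P? n (f ∘ suc)

∑ℕ-const : ∀ n c → ∑ℕ n (λ _ → c) ≡ n ℕ.* c
∑ℕ-const zero c = refl
∑ℕ-const (suc n) c = cong (c ℕ.+_) (∑ℕ-const n c)

∑ℕ-point : ∀ n t → t ℕ.< n → ∑ℕ n (λ r → 𝟙 (r ℕ.≟ t)) ≡ 1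
∑ℕ-point (suc n) zero _ =
  cong suc (trans (∑ℕ-cong n (λ r _ → 𝟙-cong {B = ⊥} (λ ()) (λ ()) (suc r ℕ.≟ 0) (no λ ())))
                  (trans (∑ℕ-const n 0) (ℕP.*-zeroʳ n)))
∑ℕ-point (suc n) (suc t) (ℕ.s≤s t<n) =
  trans (∑ℕ-cong n (λ r _ → 𝟙-cong ℕP.suc-injective (cong suc) (suc r ℕ.≟ suc t) (r ℕ.≟ t))) (∑ℕ-point n t t<n)

𝟙-partition : ∀ {A B C E : Set} (a : Dec A) (b : Dec B) (c : Dec C) (e : Dec E) →
              (E → ¬ (A ⊎ B ⊎ C)) → (¬ (A ⊎ B ⊎ C) → E) →
              (A → ¬ B) → (A → ¬ C) → (B → ¬ C) → 𝟙 e ℕ.+ 𝟙 a ℕ.+ 𝟙 b ℕ.+ 𝟙 c ≡ 1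
𝟙-partition (yes a) (yes b) _ _ _ _ ab _ _ = ⊥-elim (ab a b)
𝟙-partition (yes a) (no _) (yes c) _ _ _ _ ac _ = ⊥-elim (ac a c)
𝟙-partition (no _) (yes b) (yes c) _ _ _ _ _ bc = ⊥-elim (bc b c)
𝟙-partition (yes a) (no _) (no _) (yes e) e⇒ _ _ _ _ = ⊥-elim (e⇒ e (inj₁ a))
𝟙-partition (no _) (yes b) (no _) (yes e) e⇒ _ _ _ _ = ⊥-elim (e⇒ e (inj₂ (inj₁ b)))
𝟙-partition (no _) (no _) (yes c) (yes e) e⇒ _ _ _ _ = ⊥-elim (e⇒ e (inj₂ (inj₂ c)))
𝟙-partition (no ¬a) (no ¬b) (no ¬c) (no ¬e) _ ⇒e _ _ _ = ⊥-elim (¬e (⇒e [ ¬a , [ ¬b , ¬c ]′ ]′))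
𝟙-partition (yes _) (no _) (no _) (no _) _ _ _ _ _ = refl
𝟙-partition (no _) (yes _) (no _) (no _) _ _ _ _ _ = refl
𝟙-partition (no _) (no _) (yes _) (no _) _ _ _ _ _ = refl
𝟙-partition (no _) (no _) (no _) (yes _) _ _ _ _ _ = refl

∑ℕ-avoiding-three : ∀ n (u : ℕ → ℕ) t₁ t₂ t₃ → t₁ ℕ.< n → t₂ ℕ.< n → t₃ ℕ.< n →
  (∀ r → r ℕ.< n → u r ℕ.+ 𝟙 (r ℕ.≟ t₁) ℕ.+ 𝟙 (r ℕ.≟ t₂) ℕ.+ 𝟙 (r ℕ.≟ t₃) ≡ 1) → ∑ℕ n u ≡ n ∸ 3
∑ℕ-avoiding-three n u t₁ t₂ t₃ t₁<n t₂<n t₃<n partition =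
  trans (sym (ℕP.m+n∸n≡m (∑ℕ n u) 3)) (cong (_∸ 3) total)
  where
  at : ℕ → ℕ → ℕ
  at t r = 𝟙 (r ℕ.≟ t)
  open ≡-Reasoning
  total : ∑ℕ n u ℕ.+ 3 ≡ n
  total = begin
    ∑ℕ n u ℕ.+ 3
      ≡⟨ three (∑ℕ n u) ⟩
    ∑ℕ n u ℕ.+ 1 ℕ.+ 1 ℕ.+ 1
      ≡⟨ cong₂ ℕ._+_ (cong₂ ℕ._+_ (cong (∑ℕ n u ℕ.+_) (sym (∑ℕ-point n t₁ t₁<n))) (sym (∑ℕ-point n t₂ t₂<n)))
                     (sym (∑ℕ-point n t₃ t₃<n)) ⟩
    ∑ℕ n u ℕ.+ ∑ℕ n (at t₁) ℕ.+ ∑ℕ n (at t₂) ℕ.+ ∑ℕ n (at t₃)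
      ≡⟨ cong (ℕ._+ ∑ℕ n (at t₃)) (cong (ℕ._+ ∑ℕ n (at t₂)) (sym (∑ℕ-distrib n u (at t₁)))) ⟩
    ∑ℕ n (λ r → u r ℕ.+ at t₁ r) ℕ.+ ∑ℕ n (at t₂) ℕ.+ ∑ℕ n (at t₃)
      ≡⟨ cong (ℕ._+ ∑ℕ n (at t₃)) (sym (∑ℕ-distrib n (λ r → u r ℕ.+ at t₁ r) (at t₂))) ⟩
    ∑ℕ n (λ r → u r ℕ.+ at t₁ r ℕ.+ at t₂ r) ℕ.+ ∑ℕ n (at t₃)
      ≡⟨ sym (∑ℕ-distrib n (λ r → u r ℕ.+ at t₁ r ℕ.+ at t₂ r) (at t₃)) ⟩
    ∑ℕ n (λ r → u r ℕ.+ at t₁ r ℕ.+ at t₂ r ℕ.+ at t₃ r)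
      ≡⟨ ∑ℕ-cong n partition ⟩
    ∑ℕ n (λ _ → 1)
      ≡⟨ trans (∑ℕ-const n 1) (ℕP.*-identityʳ n) ⟩
    n ∎
    where
    three : ∀ m → m ℕ.+ 3 ≡ m ℕ.+ 1 ℕ.+ 1 ℕ.+ 1
    three = ℕSolver.solve-∀

multiple/n : ∀ n .{{_ : ℕ.NonZero n}} v → (+ n * v) / n ≡ v / 1
multiple/n n v = ℚP.≃⇒≡ (*≡* cross)
  where
  x y : ℚ
  x = (+ n * v) / n
  y = v / 1
  g : ℤ
  g = gcd (+ n * v) (+ n)
  instance
    g≢0 : ℤ.NonZero g
    g≢0 = ℤ.≢-nonZero (λ g≡0 → ℕ.≢-nonZero⁻¹ n (ℤP.+-injective (gcd[i,j]≡0⇒j≡0 {+ n * v} g≡0)))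
  ↥y : ↥ y ≡ v
  ↥y = trans (sym (ℤP.*-identityʳ _)) (trans (cong (↥ y *_) (sym (gcd-zeroʳ v))) (ℚP.↥-/ v 1))
  ↧y : ↧ y ≡ + 1
  ↧y = trans (sym (ℤP.*-identityʳ _)) (trans (cong (↧ y *_) (sym (gcd-zeroʳ v))) (ℚP.↧-/ v 1))
  -- From ↥x·g = n·v and ↧x·g = n, cancel g.
  ↥x : ↥ x ≡ v * ↧ x
  ↥x = ℤP.*-cancelʳ-≡ (↥ x) (v * ↧ x) g (begin
    ↥ x * g        ≡⟨ ℚP.↥-/ (+ n * v) n ⟩
    + n * v        ≡⟨ cong (_* v) (sym (ℚP.↧-/ (+ n * v) n)) ⟩
    ↧ x * g * v    ≡⟨ rearrange (↧ x) g v ⟩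
    v * ↧ x * g    ∎)
    where
    open ≡-Reasoning
    rearrange : ∀ a b c → a * b * c ≡ c * a * b
    rearrange = solve-∀
  cross : ↥ x * ↧ y ≡ ↥ y * ↧ x
  cross = trans (cong (↥ x *_) ↧y) (trans (ℤP.*-identityʳ _) (trans ↥x (cong (_* ↧ x) (sym ↥y))))

divℚ-zero : ∀ n → divℚ (+ 0) n ≡ 0ℚ
divℚ-zero zero = refl
divℚ-zero (suc m) = ℚP.0/n≡0 (suc m)

^-distribʳ-* : ∀ x y n → (x * y) ^ n ≡ x ^ n * y ^ n
^-distribʳ-* x y zero = refl
^-distribʳ-* x y (suc n) = trans (cong (x * y *_) (^-distribʳ-* x y n)) (swap x y (x ^ n) (y ^ n))
  where
  swap : ∀ x y a b → x * y * (a * b) ≡ x * a * (y * b)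
  swap = solve-∀

cube≡^3 : ∀ x → x * x * x ≡ x ^ 3
cube≡^3 = unfolded
  where
  -- x ^ 3 unfolds to x * (x * (x * 1)).
  unfolded : ∀ x → x * x * x ≡ x * (x * (x * + 1))
  unfolded = solve-∀

cube-^ : ∀ x n → (x * x * x) ^ n ≡ x ^ (3 ℕ.* n)
cube-^ x n = trans (cong (_^ n) (cube≡^3 x)) (ℤP.^-*-assoc x 3 n)

^-cube : ∀ x n → x ^ n * x ^ n * x ^ n ≡ x ^ (3 ℕ.* n)
^-cube x n = trans (cube≡^3 (x ^ n)) (trans (ℤP.^-*-assoc x n 3) (cong (x ^_) (ℕP.*-comm n 3)))

-- A monic polynomial of degree d, x^d + c_{d-1} x^{d-1} + … + c_0, is given
-- by its lower coefficients (c_0, …, c_{d-1}).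
Monic : ℕ → Set
Monic d = Vec ℤ d

eval : ∀ {d} → Monic d → ℤ → ℤ
eval [] x = + 1
eval (c ∷ cs) x = c + x * eval cs x

divide : ∀ {d} → Monic (suc d) → ℤ → Monic d
divide (_ ∷ []) c = []
divide (_ ∷ c′ ∷ cs) c = eval (c′ ∷ cs) c ∷ divide (c′ ∷ cs) c

divide-eval : ∀ {d} (P : Monic (suc d)) x c → eval P x - eval P c ≡ (x - c) * eval (divide P c) x
divide-eval (a ∷ []) x c = linear a x c
  where
  linear : ∀ a x c → (a + x * + 1) - (a + c * + 1) ≡ (x - c) * + 1
  linear = solve-∀
divide-eval (a ∷ a′ ∷ as) x c =
  trans (cong (λ t → (a + x * t) - (a + c * eval (a′ ∷ as) c)) Px)
        (horner a x c (eval (a′ ∷ as) c) (eval (divide (a′ ∷ as) c) x))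
  where
  Px : eval (a′ ∷ as) x ≡ eval (a′ ∷ as) c + (x - c) * eval (divide (a′ ∷ as) c) x
  Px = trans (split (eval (a′ ∷ as) x) (eval (a′ ∷ as) c)) (cong (λ t → eval (a′ ∷ as) c + t) (divide-eval (a′ ∷ as) x c))
    where
    split : ∀ u v → u ≡ v + (u - v)
    split = solve-∀
  horner : ∀ a x c Pc Q → (a + x * (Pc + (x - c) * Q)) - (a + c * Pc) ≡ (x - c) * (Pc + x * Q)
  horner = solve-∀

x^[1+_]-1 : ∀ m → Monic (suc m)
x^[1+ m ]-1 = - + 1 ∷ Vec.replicate m (+ 0)

eval-x^[1+_]-1 : ∀ m x → eval x^[1+ m ]-1 x ≡ x ^ suc m - + 1
eval-x^[1+_]-1 m x = trans (cong (λ t → - + 1 + x * t) (eval-x^ m)) (reorder x (x ^ m))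
  where
  eval-x^ : ∀ n → eval (Vec.replicate n (+ 0)) x ≡ x ^ n
  eval-x^ zero = refl
  eval-x^ (suc n) = trans (ℤP.+-identityˡ _) (cong (x *_) (eval-x^ n))
  reorder : ∀ x y → - + 1 + x * y ≡ x * y - + 1
  reorder = solve-∀

parity : ∀ n → (∃ λ h → n ≡ h ℕ.+ h) ⊎ (∃ λ h → n ≡ suc (h ℕ.+ h))
parity zero = inj₁ (0 , refl)
parity (suc n) with parity n
... | inj₁ (h , e) = inj₂ (h , cong suc e)
... | inj₂ (h , e) = inj₁ (suc h , cong suc (trans e (sym (ℕP.+-suc h h))))

odd-prime-half : ∀ k → Prime (suc (suc k)) → suc (suc k) ≢ 2 → ∃ λ h → suc k ≡ suc h ℕ.+ suc h
odd-prime-half k q-prime q≢2 with parity (suc (suc k))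
... | inj₂ (zero , ())
... | inj₂ (suc h , e) = h , ℕP.suc-injective e
... | inj₁ (h , e) = ⊥-elim ([ (λ ()) , (λ 2≡q → q≢2 (sym 2≡q)) ]′ (prime⇒irreducible q-prime 2∣q))
  where
  2∣q : 2 ℕD.∣ suc (suc k)
  2∣q = ℕD.divides h (trans e (twice h))
    where
    twice : ∀ h → h ℕ.+ h ≡ h ℕ.* 2
    twice = ℕSolver.solve-∀

q≡1[3]⇒ : ∀ k → suc (suc k) % 3 ≡ 1 → ∃ λ t → suc k ≡ 3 ℕ.* suc t
q≡1[3]⇒ k q%3≡1 = positive (suc (suc k) ℕDM./ 3)
  (ℕP.suc-injective (trans (ℕDM.m≡m%n+[m/n]*n (suc (suc k)) 3) (cong (ℕ._+ (suc (suc k) ℕDM./ 3) ℕ.* 3) q%3≡1)))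
  where
  positive : ∀ d → suc k ≡ d ℕ.* 3 → ∃ λ t → suc k ≡ 3 ℕ.* suc t
  positive (suc t) e = t , trans e (ℕP.*-comm (suc t) 3)

-- If q = 3 or q ≡ 2 (mod 3) then 3 e = 1 + m (q − 1) for some e and m:
-- e = m = 1 for q = 3, and e = 2t + 1, m = 2 for q = 3t + 2.
cubing-exponent : ∀ k → suc (suc k) ≡ 3 ⊎ suc (suc k) % 3 ≡ 2 → ∃ λ e → ∃ λ m → 3 ℕ.* e ≡ 1 ℕ.+ m ℕ.* suc k
cubing-exponent .1 (inj₁ refl) = 1 , 1 , refl
cubing-exponent k (inj₂ q%3≡2) = 2 ℕ.* t ℕ.+ 1 , 2 , trans (identity t) (cong (λ n → 1 ℕ.+ 2 ℕ.* suc n) (sym k≡3t))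
  where
  t : ℕ
  t = suc (suc k) ℕDM./ 3
  k≡3t : k ≡ t ℕ.* 3
  k≡3t = ℕP.suc-injective (ℕP.suc-injective (trans (ℕDM.m≡m%n+[m/n]*n (suc (suc k)) 3) (cong (ℕ._+ t ℕ.* 3) q%3≡2)))
  identity : ∀ t → 3 ℕ.* (2 ℕ.* t ℕ.+ 1) ≡ 1 ℕ.+ 2 ℕ.* (1 ℕ.+ t ℕ.* 3)
  identity = ℕSolver.solve-∀

module PrimeModulus (k : ℕ) (q-prime : Prime (suc (suc k))) where

  q : ℕ
  q = suc (suc k)

  -- Divisibility by q (signed divisibility, which has the closure lemmas).
  q∣_ : ℤ → Set
  q∣ x = + q Signed.∣ x

  q∣? : ∀ x → Dec (q∣ x)
  q∣? x = + q Signed.∣? x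

  q∣-resp : ∀ {x y} → x ≡ y → q∣ x → q∣ y
  q∣-resp refl d = d

  q∣0 : q∣ (+ 0)
  q∣0 = Signed.divides (+ 0) refl

  q∣-+ : ∀ {x y} → q∣ x → q∣ y → q∣ (x + y)
  q∣-+ = Signed.∣m∣n⇒∣m+n

  q∣-*ˡ : ∀ y {x} → q∣ x → q∣ (y * x)
  q∣-*ˡ = Signed.∣n⇒∣m*n

  q∣-*ʳ : ∀ y {x} → q∣ x → q∣ (x * y)
  q∣-*ʳ y d = Signed.∣m⇒∣m*n y d

  q∣-multiple : ∀ {u} x s → x ≡ s * u → q∣ u → q∣ x
  q∣-multiple x s eq du = q∣-resp (sym eq) (q∣-*ˡ s du)

  q∣-combination : ∀ {u v} x s t → x ≡ s * u + t * v → q∣ u → q∣ v → q∣ x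
  q∣-combination x s t eq du dv = q∣-resp (sym eq) (q∣-+ (q∣-*ˡ s du) (q∣-*ˡ t dv))

  q∣-combination₃ : ∀ {u v w} x s t r → x ≡ s * u + t * v + r * w → q∣ u → q∣ v → q∣ w → q∣ x
  q∣-combination₃ x s t r eq du dv dw = q∣-resp (sym eq) (q∣-+ (q∣-+ (q∣-*ˡ s du) (q∣-*ˡ t dv)) (q∣-*ˡ r dw))

  q∣-product : ∀ x y → q∣ (x * y) → q∣ x ⊎ q∣ y
  q∣-product x y d with euclidsLemma ∣ x ∣ ∣ y ∣ q-prime (ℕD.∣-trans (Signed.∣⇒∣ᵤ d) (ℕD.∣-reflexive (ℤP.abs-* x y)))
  ... | inj₁ q∣x = inj₁ (Signed.∣ᵤ⇒∣ q∣x)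
  ... | inj₂ q∣y = inj₂ (Signed.∣ᵤ⇒∣ q∣y)

  q∣-small : ∀ {r} → r ℕ.< q → q∣ (+ r) → r ≡ 0
  q∣-small {zero} _ _ = refl
  q∣-small {suc r} r<q d = ⊥-elim (ℕD.>⇒∤ r<q (Signed.∣⇒∣ᵤ d))

  1<q : 1 ℕ.< q
  1<q = ℕ.s≤s (ℕ.s≤s ℕ.z≤n)

  ¬q∣1 : ¬ q∣ (+ 1)
  ¬q∣1 d with q∣-small 1<q d
  ... | ()

  residues-distinct : ∀ r s → r ℕ.< q → s ℕ.< q → q∣ (+ r - + s) → r ≡ s
  residues-distinct r s r<q s<q d with ℕP.≤-total s r
  ... | inj₁ s≤r = ℕP.≤-antisym (ℕP.m∸n≡0⇒m≤n (q∣-small (ℕP.≤-<-trans (ℕP.m∸n≤m r s) r<q)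
          (q∣-resp (trans (ℤP.m-n≡m⊖n r s) (ℤP.⊖-≥ s≤r)) d))) s≤r
  ... | inj₂ r≤s = ℕP.≤-antisym r≤s (ℕP.m∸n≡0⇒m≤n (q∣-small (ℕP.≤-<-trans (ℕP.m∸n≤m s r) s<q)
          (q∣-resp (trans (ℤP.m-n≡m⊖n s r) (ℤP.⊖-≥ r≤s)) (q∣-multiple _ (- + 1) (flip (+ r) (+ s)) d))))
    where
    flip : ∀ x y → y - x ≡ - + 1 * (x - y)
    flip = solve-∀

  infix 4 _≈_
  record _≈_ (x y : ℤ) : Set where
    constructor mk≈
    field un≈ : q∣ (x - y)
  open _≈_ public

  ≈-refl : ∀ {x} → x ≈ x
  ≈-refl {x} = mk≈ (q∣-multiple (x - x) (+ 0) (self x) q∣0)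
    where
    self : ∀ x → x - x ≡ + 0 * + 0
    self = solve-∀

  ≈-reflexive : ∀ {x y} → x ≡ y → x ≈ y
  ≈-reflexive refl = ≈-refl

  ≈-sym : ∀ {x y} → x ≈ y → y ≈ x
  ≈-sym {x} {y} (mk≈ d) = mk≈ (q∣-multiple _ (- + 1) (flip x y) d)
    where
    flip : ∀ x y → y - x ≡ - + 1 * (x - y)
    flip = solve-∀

  ≈-trans : ∀ {x y z} → x ≈ y → y ≈ z → x ≈ z
  ≈-trans {x} {y} {z} (mk≈ d) (mk≈ e) = mk≈ (q∣-combination _ (+ 1) (+ 1) (chain x y z) d e)
    where
    chain : ∀ x y z → x - z ≡ + 1 * (x - y) + + 1 * (y - z)
    chain = solve-∀

  +-cong : ∀ {x x′ y y′} → x ≈ x′ → y ≈ y′ → x + y ≈ x′ + y′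
  +-cong {x} {x′} {y} {y′} (mk≈ d) (mk≈ e) = mk≈ (q∣-combination _ (+ 1) (+ 1) (split x x′ y y′) d e)
    where
    split : ∀ x x′ y y′ → (x + y) - (x′ + y′) ≡ + 1 * (x - x′) + + 1 * (y - y′)
    split = solve-∀

  *-cong : ∀ {x x′ y y′} → x ≈ x′ → y ≈ y′ → x * y ≈ x′ * y′
  *-cong {x} {x′} {y} {y′} (mk≈ d) (mk≈ e) = mk≈ (q∣-combination _ y x′ (split x x′ y y′) d e)
    where
    split : ∀ x x′ y y′ → (x * y) - (x′ * y′) ≡ y * (x - x′) + x′ * (y - y′)
    split = solve-∀

  cube-cong : ∀ {x y} → x ≈ y → x * x * x ≈ y * y * y
  cube-cong e = *-cong (*-cong e e) e

  ^-cong : ∀ {x y} n → x ≈ y → x ^ n ≈ y ^ n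
  ^-cong zero e = ≈-refl
  ^-cong (suc n) e = *-cong e (^-cong n e)

  q∣-resp-≈ : ∀ {x y} → x ≈ y → q∣ y → q∣ x
  q∣-resp-≈ {x} {y} (mk≈ d) e = q∣-combination _ (+ 1) (+ 1) (split x y) d e
    where
    split : ∀ x y → x ≡ + 1 * (x - y) + + 1 * y
    split = solve-∀

  q∣⇒≈0 : ∀ {x} → q∣ x → x ≈ + 0
  q∣⇒≈0 {x} d = mk≈ (q∣-resp (sym (ℤP.+-identityʳ x)) d)

  ≈0⇒q∣ : ∀ {x} → x ≈ + 0 → q∣ x
  ≈0⇒q∣ {x} (mk≈ d) = q∣-resp (ℤP.+-identityʳ x) d

  ≈-residue : ∀ x → x ≈ + (x %ℕ q)
  ≈-residue x = mk≈ (q∣-multiple _ (x /ℕ q) (difference x (a≡a%ℕn+[a/ℕn]*n x q)) (Signed.∣m⇒∣m*n (+ 1) Signed.∣-refl))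
    where
    difference : ∀ x → x ≡ + (x %ℕ q) + (x /ℕ q) * + q → x - + (x %ℕ q) ≡ (x /ℕ q) * (+ q * + 1)
    difference x eq = trans (cong (_- + (x %ℕ q)) eq) (rearrange (+ (x %ℕ q)) (x /ℕ q) (+ q))
      where
      rearrange : ∀ r d q → (r + d * q) - r ≡ d * (q * + 1)
      rearrange = solve-∀

  residue-cong : ∀ {x y} → x ≈ y → x %ℕ q ≡ y %ℕ q
  residue-cong {x} {y} e = residues-distinct _ _ (n%ℕd<d x q) (n%ℕd<d y q)
    (un≈ (≈-trans (≈-sym (≈-residue x)) (≈-trans e (≈-residue y))))

  residue-injective : ∀ x y → x %ℕ q ≡ y %ℕ q → x ≈ y
  residue-injective x y e = ≈-trans (≈-residue x) (≈-trans (≈-reflexive (cong +_ e)) (≈-sym (≈-residue y)))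

  q∣⇒residue≡0 : ∀ {x} → q∣ x → x %ℕ q ≡ 0
  q∣⇒residue≡0 d = residue-cong (q∣⇒≈0 d)

  residue≡0⇒q∣ : ∀ x → x %ℕ q ≡ 0 → q∣ x
  residue≡0⇒q∣ x e = ≈0⇒q∣ (≈-trans (≈-residue x) (≈-reflexive (cong +_ e)))

  unit-* : ∀ {x y} → ¬ q∣ x → ¬ q∣ y → ¬ q∣ (x * y)
  unit-* {x} {y} ¬x ¬y d = [ ¬x , ¬y ]′ (q∣-product x y d)

  unit-suc : ∀ r → suc r ℕ.< q → ¬ q∣ (+ suc r)
  unit-suc r lt d with q∣-small lt d
  ... | ()

  unit-factorʳ : ∀ y {z} → y * z ≈ + 1 → ¬ q∣ z
  unit-factorʳ y e d = ¬q∣1 (q∣-resp-≈ (≈-sym e) (q∣-*ˡ y d))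

  cancel : ∀ {g x y} → ¬ q∣ g → g * x ≈ g * y → x ≈ y
  cancel {g} {x} {y} ¬g (mk≈ d) = [ (λ q∣g → ⊥-elim (¬g q∣g)) , mk≈ ]′ (q∣-product g (x - y) (q∣-resp (factor g x y) d))
    where
    factor : ∀ g x y → g * x - g * y ≡ g * (x - y)
    factor = solve-∀

  divide-root : ∀ {d} (P : Monic (suc d)) {x c} → ¬ x ≈ c → q∣ eval P x → q∣ eval P c →
                q∣ eval (divide P c) x
  divide-root P {x} {c} x≉c Px Pc =
    [ (λ q∣x-c → ⊥-elim (x≉c (mk≈ q∣x-c))) , (λ root → root) ]′
    (q∣-product (x - c) _ (q∣-resp (divide-eval P x c) (q∣-combination _ (+ 1) (- + 1) (diff (eval P x) (eval P c)) Px Pc)))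
    where
    diff : ∀ u v → u - v ≡ + 1 * u + - + 1 * v
    diff = solve-∀

  lagrange : ∀ d (P : Monic d) (c : ℕ → ℤ) → (∀ i j → j ℕ.< i → i ℕ.< d → ¬ c j ≈ c i) →
             (∀ i → i ℕ.< d → q∣ eval P (c i)) → ∀ x → q∣ eval P x → ∃ λ i → i ℕ.< d × x ≈ c i
  lagrange zero [] c _ _ x P1 = ⊥-elim (¬q∣1 P1)
  lagrange (suc d) P c distinct roots x Px = decide (q∣? (x - c d))
    where
    roots′ : ∀ i → i ℕ.< d → q∣ eval (divide P (c d)) (c i)
    roots′ i i<d = divide-root P (distinct d i i<d ℕP.≤-refl) (roots i (ℕP.m<n⇒m<1+n i<d)) (roots d ℕP.≤-refl)
    decide : Dec (q∣ (x - c d)) → ∃ λ i → i ℕ.< suc d × x ≈ c i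
    decide (yes x≡cd) = d , ℕP.≤-refl , mk≈ x≡cd
    decide (no x≢cd) =
      let (i , i<d , x≈ci) = lagrange d (divide P (c d)) c (λ i j j<i i<d → distinct i j j<i (ℕP.m<n⇒m<1+n i<d))
                               roots′ x (divide-root P (x≢cd ∘ un≈) Px (roots d ℕP.≤-refl))
      in i , ℕP.m<n⇒m<1+n i<d , x≈ci

  root-bound : ∀ d (P : Monic d) (c : ℕ → ℤ) → (∀ i j → j ℕ.< i → i ℕ.< suc d → ¬ c j ≈ c i) →
               (∀ i → i ℕ.< suc d → q∣ eval P (c i)) → ⊥
  root-bound d P c distinct roots =
    let (i , i<d , cd≈ci) = lagrange d P c (λ i j j<i i<d → distinct i j j<i (ℕP.m<n⇒m<1+n i<d))
                              (λ i i<d → roots i (ℕP.m<n⇒m<1+n i<d)) (c d) (roots d ℕP.≤-refl)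
    in distinct d i i<d ℕP.≤-refl (≈-sym cd≈ci)

  *-commutativeMonoid : CommutativeMonoid 0ℓ 0ℓ
  *-commutativeMonoid = record
    { Carrier = ℤ ; _≈_ = _≈_ ; _∙_ = _*_ ; ε = + 1
    ; isCommutativeMonoid = record
      { isMonoid = record
        { isSemigroup = record
          { isMagma = record
            { isEquivalence = record { refl = ≈-refl ; sym = ≈-sym ; trans = ≈-trans }
            ; ∙-cong = *-cong }
          ; assoc = λ x y z → ≈-reflexive (ℤP.*-assoc x y z) }
        ; identity = (λ x → ≈-reflexive (ℤP.*-identityˡ x)) , (λ x → ≈-reflexive (ℤP.*-identityʳ x)) }
      ; comm = λ x y → ≈-reflexive (ℤP.*-comm x y) } }

  open RangeSum *-commutativeMonoid using () renaming (∑< to ∏; ∑<-cong to ∏-cong; ∑<-reindex to ∏-reindex)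

  ∏-scale : ∀ n g (h : ℕ → ℤ) → ∏ n (λ r → g * h r) ≈ g ^ n * ∏ n h
  ∏-scale zero g h = ≈-refl
  ∏-scale (suc n) g h = ≈-trans (*-cong (≈-refl {g * h 0}) (∏-scale n g (h ∘ suc)))
                                (≈-reflexive (swap g (h 0) (g ^ n) (∏ n (h ∘ suc))))
    where
    swap : ∀ g a b c → g * a * (b * c) ≡ g * b * (a * c)
    swap = solve-∀

  ∏-unit : ∀ n (h : ℕ → ℤ) → (∀ r → r ℕ.< n → ¬ q∣ h r) → ¬ q∣ ∏ n h
  ∏-unit zero h units = ¬q∣1
  ∏-unit (suc n) h units = unit-* (units 0 (ℕ.s≤s ℕ.z≤n)) (∏-unit n (h ∘ suc) (λ r r<n → units (suc r) (ℕ.s≤s r<n)))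

  -- Fermat: multiplication by a unit g permutes the nonzero residues 1, …, q − 1,
  -- so their product P satisfies P ≡ g^(q−1) P, and P is a unit.
  fermat : ∀ g → ¬ q∣ g → g ^ suc k ≈ + 1
  fermat g ¬g = cancel P-unit (≈-trans (≈-reflexive (ℤP.*-comm P (g ^ suc k)))
                                       (≈-trans (≈-sym P≈g^P) (≈-reflexive (sym (ℤP.*-identityʳ P)))))
    where
    n : ℕ
    n = suc k
    nonzero : ℕ → ℤ
    nonzero r = + suc r
    P : ℤ
    P = ∏ n nonzero
    P-unit : ¬ q∣ P
    P-unit = ∏-unit n nonzero (λ r r<n → unit-suc r (ℕ.s≤s r<n))
    -- σ r is the index of the residue of g (r + 1).
    σ : ℕ → ℕ
    σ r = ((g * nonzero r) %ℕ q) ∸ 1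
    residue≢0 : ∀ r → r ℕ.< n → (g * nonzero r) %ℕ q ≢ 0
    residue≢0 r r<n e = unit-* ¬g (unit-suc r (ℕ.s≤s r<n)) (residue≡0⇒q∣ (g * nonzero r) e)
    suc-σ : ∀ r → r ℕ.< n → suc (σ r) ≡ (g * nonzero r) %ℕ q
    suc-σ r r<n with (g * nonzero r) %ℕ q in eq
    ... | zero = ⊥-elim (residue≢0 r r<n eq)
    ... | suc _ = refl
    σ-into : ∀ r → r ℕ.< n → σ r ℕ.< n
    σ-into r r<n with (g * nonzero r) %ℕ q in eq | n%ℕd<d (g * nonzero r) q
    ... | zero | _ = ⊥-elim (residue≢0 r r<n eq)
    ... | suc _ | ℕ.s≤s σr<n = σr<n
    σ-inj : ∀ r s → r ℕ.< n → s ℕ.< n → σ r ≡ σ s → r ≡ s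
    σ-inj r s r<n s<n e = ℕP.suc-injective (residues-distinct (suc r) (suc s) (ℕ.s≤s r<n) (ℕ.s≤s s<n)
      (un≈ (cancel ¬g (residue-injective (g * nonzero r) (g * nonzero s) (trans (sym (suc-σ r r<n)) (trans (cong suc e) (suc-σ s s<n)))))))
    nonzero-σ : ∀ r → r ℕ.< n → nonzero (σ r) ≈ g * nonzero r
    nonzero-σ r r<n = ≈-trans (≈-reflexive (cong +_ (suc-σ r r<n))) (≈-sym (≈-residue (g * nonzero r)))
    P≈g^P : P ≈ g ^ n * P
    P≈g^P = ≈-trans (∏-reindex n nonzero σ σ-into σ-inj) (≈-trans (∏-cong n nonzero-σ) (∏-scale n g nonzero))

  ^-fermat : ∀ m x → x ^ (1 ℕ.+ m ℕ.* suc k) ≈ x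
  ^-fermat m x with q∣? x
  ... | yes q∣x = ≈-trans (q∣⇒≈0 (q∣-*ʳ (x ^ (m ℕ.* suc k)) q∣x)) (≈-sym (q∣⇒≈0 q∣x))
  ... | no ¬q∣x = begin
    x * x ^ (m ℕ.* suc k)     ≈⟨ *-cong (≈-refl {x}) (≈-reflexive (trans (cong (x ^_) (ℕP.*-comm m (suc k)))
                                                                         (sym (ℤP.^-*-assoc x (suc k) m)))) ⟩
    x * (x ^ suc k) ^ m       ≈⟨ *-cong (≈-refl {x}) (^-cong m (fermat x ¬q∣x)) ⟩
    x * (+ 1) ^ m             ≈⟨ ≈-reflexive (trans (cong (x *_) (ℤP.^-zeroˡ m)) (ℤP.*-identityʳ x)) ⟩
    x                         ∎
    where open import Relation.Binary.Reasoning.Setoid (CommutativeMonoid.setoid *-commutativeMonoid)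

  ∑ℤ-permute : (G : ℤ → ℤ) → (∀ {x y} → x ≈ y → G x ≡ G y) →
               (σ : ℤ → ℤ) → (∀ {x y} → σ x ≈ σ y → x ≈ y) →
               ∑ℤ q (λ r → G (+ r)) ≡ ∑ℤ q (λ r → G (σ (+ r)))
  ∑ℤ-permute G G-cong σ σ-inj =
    trans (∑ℤ-reindex q (G ∘ +_) τ (λ r _ → n%ℕd<d (σ (+ r)) q) τ-inj)
          (∑ℤ-cong q (λ r _ → G-cong (≈-sym (≈-residue (σ (+ r))))))
    where
    τ : ℕ → ℕ
    τ r = σ (+ r) %ℕ q
    τ-inj : ∀ r s → r ℕ.< q → s ℕ.< q → τ r ≡ τ s → r ≡ s
    τ-inj r s r<q s<q e = residues-distinct r s r<q s<q (un≈ (σ-inj (residue-injective (σ (+ r)) (σ (+ s)) e)))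

  IsSquare : ℤ → Set
  IsSquare n = ∃ λ s → s * s ≈ n

  -- The Fin-search inside the definition of the Legendre symbol decides IsSquare.
  private
    FinSquare : ℤ → Set
    FinSquare n = ∃ λ (r : Fin q) → (toℕ r ℕ.* toℕ r) % q ≡ n %ℕ q

    FinSquare⇒IsSquare : ∀ {n} → FinSquare n → IsSquare n
    FinSquare⇒IsSquare {n} (r , e) = + toℕ r , ≈-trans (≈-reflexive (sym (ℤP.pos-* (toℕ r) (toℕ r))))
      (≈-trans (≈-residue (+ (toℕ r ℕ.* toℕ r))) (≈-trans (≈-reflexive (cong +_ e)) (≈-sym (≈-residue n))))

    IsSquare⇒FinSquare : ∀ {n} → IsSquare n → FinSquare n
    IsSquare⇒FinSquare {n} (s , e) = fromℕ< (n%ℕd<d s q) ,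
      trans (cong (λ t → (t ℕ.* t) % q) (FinP.toℕ-fromℕ< (n%ℕd<d s q)))
            (residue-cong (≈-trans (≈-reflexive (ℤP.pos-* (s %ℕ q) (s %ℕ q)))
                                   (≈-trans (*-cong (≈-sym (≈-residue s)) (≈-sym (≈-residue s))) e)))

  square? : ∀ n → Dec (IsSquare n)
  square? n with FinP.any? (λ (r : Fin q) → ((toℕ r ℕ.* toℕ r) % q) ℕ.≟ n %ℕ q)
  ... | yes sq = yes (FinSquare⇒IsSquare sq)
  ... | no ¬sq = no (λ sq → ¬sq (IsSquare⇒FinSquare sq))

  legendre-zero : ∀ n → q∣ n → legendre n q ≡ + 0
  legendre-zero n d with n %ℕ q in eq
  ... | zero = refl
  ... | suc j = ⊥-elim (ℕP.1+n≢0 (trans (sym eq) (q∣⇒residue≡0 d)))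

  legendre-square : ∀ n → ¬ q∣ n → IsSquare n → legendre n q ≡ + 1
  legendre-square n ¬d sq with n %ℕ q in eq
  ... | zero = ⊥-elim (¬d (residue≡0⇒q∣ n eq))
  ... | suc j with FinP.any? (λ (r : Fin q) → ((toℕ r ℕ.* toℕ r) % q) ℕ.≟ suc j)
  ...   | yes _ = refl
  ...   | no ¬sq = ⊥-elim (¬sq (proj₁ (IsSquare⇒FinSquare sq) , trans (proj₂ (IsSquare⇒FinSquare sq)) eq))

  legendre-nonsquare : ∀ n → ¬ q∣ n → ¬ IsSquare n → legendre n q ≡ - + 1
  legendre-nonsquare n ¬d ¬sq with n %ℕ q in eq
  ... | zero = ⊥-elim (¬d (residue≡0⇒q∣ n eq))
  ... | suc j with FinP.any? (λ (r : Fin q) → ((toℕ r ℕ.* toℕ r) % q) ℕ.≟ suc j)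
  ...   | yes (r , e) = ⊥-elim (¬sq (FinSquare⇒IsSquare (r , trans e (sym eq))))
  ...   | no _ = refl

  Trit : ℤ → Set
  Trit v = v ≡ + 0 ⊎ v ≡ + 1 ⊎ v ≡ - + 1

  legendre-trit : ∀ n → Trit (legendre n q)
  legendre-trit n with n %ℕ q
  ... | zero = inj₁ refl
  ... | suc j with FinP.any? (λ (r : Fin q) → ((toℕ r ℕ.* toℕ r) % q) ℕ.≟ suc j)
  ...   | yes _ = inj₂ (inj₁ refl)
  ...   | no _ = inj₂ (inj₂ refl)

  -- If every unit g satisfied g^(m+1) ≡ 1 with m + 2 < q, then 1, …, m + 2 would
  -- be m + 2 incongruent roots of x^(m+1) − 1.
  non-root : ∀ m → suc (suc m) ℕ.< q → ∃ λ g → ¬ q∣ g × ¬ (g ^ suc m ≈ + 1)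
  non-root m m+2<q with FinP.any? (λ (i : Fin (suc (suc m))) → ¬? (q∣? ((+ suc (toℕ i)) ^ suc m - + 1)))
  ... | yes (i , ¬root) = + suc (toℕ i) , unit-suc (toℕ i) (ℕP.≤-<-trans (FinP.toℕ<n i) m+2<q) , ¬root ∘ un≈
  ... | no none = ⊥-elim (root-bound (suc m) x^[1+ m ]-1 (λ i → + suc i) distinct roots)
    where
    distinct : ∀ i j → j ℕ.< i → i ℕ.< suc (suc m) → ¬ + suc j ≈ + suc i
    distinct i j j<i i<m+2 (mk≈ d) = ℕP.<-irrefl (ℕP.suc-injective
      (residues-distinct (suc j) (suc i) (ℕP.<-trans (ℕ.s≤s j<i) (ℕP.≤-<-trans i<m+2 m+2<q)) (ℕP.≤-<-trans i<m+2 m+2<q) d)) j<i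
    roots : ∀ i → i ℕ.< suc (suc m) → q∣ eval x^[1+ m ]-1 (+ suc i)
    roots i i<m+2 = q∣-resp (sym (eval-x^[1+ m ]-1 (+ suc i)))
      (decidable-stable (q∣? _) (λ ¬root → none (fromℕ< i<m+2 ,
        subst (λ t → ¬ q∣ ((+ suc t) ^ suc m - + 1)) (sym (FinP.toℕ-fromℕ< i<m+2)) ¬root)))

  gcd≡1⇒unit : ∀ x → gcd x (+ q) ≡ + 1 → ¬ q∣ x
  gcd≡1⇒unit x e d = ℕP.<-irrefl refl (ℕP.≤-<-trans
    (ℕD.∣⇒≤ (subst (q ℕD.∣_) (ℤP.+-injective e) (ℕGCD.gcd-greatest (Signed.∣⇒∣ᵤ d) ℕD.∣-refl)))
    1<q)

  unit⇒gcd≡1 : ∀ x → ¬ q∣ x → gcd x (+ q) ≡ + 1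
  unit⇒gcd≡1 x ¬d = [ cong (λ n → + n) , (λ e → ⊥-elim (¬d (Signed.∣ᵤ⇒∣ (subst (ℕD._∣ ∣ x ∣) e (ℕGCD.gcd[m,n]∣m ∣ x ∣ q))))) ]′
    (prime⇒irreducible q-prime (ℕGCD.gcd[m,n]∣n ∣ x ∣ q))

  -- The number of residues r at which F(r) is a unit (the denominator of a_q).
  unitCount : (ℤ → ℤ) → ℕ
  unitCount F = length (filter (λ r → gcd (F (+ r)) (+ q) ℤ.≟ + 1) (upTo q))

  unitCount-∑ : ∀ F → unitCount F ≡ ∑ℕ q (λ r → 𝟙 (¬? (q∣? (F (+ r)))))
  unitCount-∑ F = trans (length-filter (λ r → gcd (F (+ r)) (+ q) ℤ.≟ + 1) q (λ r → r))
    (∑ℕ-cong q (λ r _ → 𝟙-cong (gcd≡1⇒unit (F (+ r))) (unit⇒gcd≡1 (F (+ r))) (gcd (F (+ r)) (+ q) ℤ.≟ + 1) (¬? (q∣? (F (+ r))))))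

  unitCount-all : ∀ F → (∀ r → r ℕ.< q → ¬ q∣ F (+ r)) → unitCount F ≡ q
  unitCount-all F units = trans (unitCount-∑ F)
    (trans (∑ℕ-cong q (λ r r<q → 𝟙-cong (λ _ → tt) (λ _ → units r r<q) (¬? (q∣? (F (+ r)))) (yes tt)))
           (trans (∑ℕ-const q 1) (ℕP.*-identityʳ q)))

  unitCount-three-roots : ∀ F s₁ s₂ s₃ → ¬ s₁ ≈ s₂ → ¬ s₁ ≈ s₃ → ¬ s₂ ≈ s₃ →
    (∀ x → q∣ F x → x ≈ s₁ ⊎ x ≈ s₂ ⊎ x ≈ s₃) → (∀ x → x ≈ s₁ ⊎ x ≈ s₂ ⊎ x ≈ s₃ → q∣ F x) →
    unitCount F ≡ q ∸ 3
  unitCount-three-roots F s₁ s₂ s₃ s₁≉s₂ s₁≉s₃ s₂≉s₃ zeros⇒ ⇒zeros =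
    trans (unitCount-∑ F) (∑ℕ-avoiding-three q unit (s₁ %ℕ q) (s₂ %ℕ q) (s₃ %ℕ q)
                                               (n%ℕd<d s₁ q) (n%ℕd<d s₂ q) (n%ℕd<d s₃ q) partition)
    where
    unit : ℕ → ℕ
    unit r = 𝟙 (¬? (q∣? (F (+ r))))
    class⇒residue : ∀ {r} s → r ℕ.< q → + r ≈ s → r ≡ s %ℕ q
    class⇒residue s r<q e = trans (sym (ℕDM.m<n⇒m%n≡m r<q)) (residue-cong e)
    residue⇒class : ∀ {r} s → r ≡ s %ℕ q → + r ≈ s
    residue⇒class s e = ≈-trans (≈-reflexive (cong +_ e)) (≈-sym (≈-residue s))
    partition : ∀ r → r ℕ.< q → unit r ℕ.+ 𝟙 (r ℕ.≟ s₁ %ℕ q) ℕ.+ 𝟙 (r ℕ.≟ s₂ %ℕ q) ℕ.+ 𝟙 (r ℕ.≟ s₃ %ℕ q) ≡ 1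
    partition r r<q = 𝟙-partition (r ℕ.≟ s₁ %ℕ q) (r ℕ.≟ s₂ %ℕ q) (r ℕ.≟ s₃ %ℕ q) (¬? (q∣? (F (+ r))))
      (λ ¬zero → ¬zero ∘ ⇒zeros (+ r) ∘
        [ inj₁ ∘ residue⇒class s₁ , [ inj₂ ∘ inj₁ ∘ residue⇒class s₂ , inj₂ ∘ inj₂ ∘ residue⇒class s₃ ]′ ]′)
      (λ ¬root zero → ¬root
        ([ inj₁ ∘ class⇒residue s₁ r<q , [ inj₂ ∘ inj₁ ∘ class⇒residue s₂ r<q , inj₂ ∘ inj₂ ∘ class⇒residue s₃ r<q ]′ ]′
         (zeros⇒ (+ r) zero)))
      (λ e₁ e₂ → s₁≉s₂ (residue-injective s₁ s₂ (trans (sym e₁) e₂)))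
      (λ e₁ e₃ → s₁≉s₃ (residue-injective s₁ s₃ (trans (sym e₁) e₃)))
      (λ e₂ e₃ → s₂≉s₃ (residue-injective s₂ s₃ (trans (sym e₂) e₃)))

  -- If 3e = 1 + m(q − 1) then x ↦ x³ is injective modulo q, with inverse x ↦ x^e.
  cube-injective : ∀ e m → 3 ℕ.* e ≡ 1 ℕ.+ m ℕ.* suc k → ∀ {x y} → x * x * x ≈ y * y * y → x ≈ y
  cube-injective e m 3e≡ {x} {y} x³≈y³ = ≈-trans (≈-sym (inverse x)) (≈-trans (^-cong e x³≈y³) (inverse y))
    where
    inverse : ∀ x → (x * x * x) ^ e ≈ x
    inverse x = ≈-trans (≈-reflexive (trans (cube-^ x e) (cong (x ^_) 3e≡))) (^-fermat m x)

module OddPrime (k : ℕ) (q-prime : Prime (suc (suc k))) (h : ℕ) (q-1≡2h : suc k ≡ suc h ℕ.+ suc h) where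
  open PrimeModulus k q-prime public

  half : ℕ
  half = suc h

  half+half<q : half ℕ.+ half ℕ.< q
  half+half<q = ℕ.s≤s (ℕP.≤-reflexive (sym q-1≡2h))

  -- q ≥ 3, so the exponent q − 2 = k is positive.
  k≡1+2h : k ≡ suc (h ℕ.+ h)
  k≡1+2h = trans (ℕP.suc-injective q-1≡2h) (ℕP.+-suc h h)

  half<q : half ℕ.< q
  half<q = ℕP.≤-<-trans (ℕP.m≤m+n half half) half+half<q

  q∤small : ∀ {v n} → ∣ v ∣ ≡ suc n → suc n ℕ.< q → ¬ q∣ v
  q∤small e lt d = ℕD.>⇒∤ lt (subst (q ℕD.∣_) e (Signed.∣⇒∣ᵤ d))

  2<q : 2 ℕ.< q
  2<q = ℕP.≤-<-trans (ℕP.+-mono-≤ (ℕ.s≤s ℕ.z≤n) (ℕ.s≤s ℕ.z≤n)) half+half<q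

  -- Distinct elements of {0, 1, −1} are incongruent modulo q, as q > 2.
  trit-≈ : ∀ {a b} → Trit a → Trit b → a ≈ b → a ≡ b
  trit-≈ (inj₁ refl) (inj₁ refl) _ = refl
  trit-≈ (inj₂ (inj₁ refl)) (inj₂ (inj₁ refl)) _ = refl
  trit-≈ (inj₂ (inj₂ refl)) (inj₂ (inj₂ refl)) _ = refl
  trit-≈ (inj₁ refl) (inj₂ (inj₁ refl)) (mk≈ d) = ⊥-elim (q∤small refl 1<q d)
  trit-≈ (inj₁ refl) (inj₂ (inj₂ refl)) (mk≈ d) = ⊥-elim (q∤small refl 1<q d)
  trit-≈ (inj₂ (inj₁ refl)) (inj₁ refl) (mk≈ d) = ⊥-elim (q∤small refl 1<q d)
  trit-≈ (inj₂ (inj₂ refl)) (inj₁ refl) (mk≈ d) = ⊥-elim (q∤small refl 1<q d)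
  trit-≈ (inj₂ (inj₁ refl)) (inj₂ (inj₂ refl)) (mk≈ d) = ⊥-elim (q∤small refl 2<q d)
  trit-≈ (inj₂ (inj₂ refl)) (inj₂ (inj₁ refl)) (mk≈ d) = ⊥-elim (q∤small refl 2<q d)

  trit-* : ∀ {a b} → Trit a → Trit b → Trit (a * b)
  trit-* (inj₁ refl) _ = inj₁ refl
  trit-* (inj₂ (inj₁ refl)) (inj₁ refl) = inj₁ refl
  trit-* (inj₂ (inj₁ refl)) (inj₂ (inj₁ refl)) = inj₂ (inj₁ refl)
  trit-* (inj₂ (inj₁ refl)) (inj₂ (inj₂ refl)) = inj₂ (inj₂ refl)
  trit-* (inj₂ (inj₂ refl)) (inj₁ refl) = inj₁ refl
  trit-* (inj₂ (inj₂ refl)) (inj₂ (inj₁ refl)) = inj₂ (inj₂ refl)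
  trit-* (inj₂ (inj₂ refl)) (inj₂ (inj₂ refl)) = inj₂ (inj₁ refl)

  trit-cube : ∀ {v} → Trit v → v * v * v ≡ v
  trit-cube (inj₁ refl) = refl
  trit-cube (inj₂ (inj₁ refl)) = refl
  trit-cube (inj₂ (inj₂ refl)) = refl

  ^half-^half : ∀ x → x ^ half * x ^ half ≡ x ^ suc k
  ^half-^half x = trans (sym (ℤP.^-distribˡ-+-* x half half)) (cong (x ^_) (sym q-1≡2h))

  square^half : ∀ s → ¬ q∣ s → (s * s) ^ half ≈ + 1
  square^half s ¬q∣s = ≈-trans (≈-reflexive (trans (^-distribʳ-* s s half) (^half-^half s))) (fermat s ¬q∣s)

  -- The squares 1², …, half² are half incongruent roots of x^half − 1, so by
  -- Lagrange every root of x^half − 1 is a square.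
  nonsquare^half : ∀ x → ¬ IsSquare x → ¬ (x ^ half ≈ + 1)
  nonsquare^half x ¬sq (mk≈ root) =
    let (i , _ , x≈sq) = lagrange half x^[1+ h ]-1 square distinct roots x
                           (q∣-resp (sym (eval-x^[1+ h ]-1 x)) root)
    in ¬sq (+ suc i , ≈-sym x≈sq)
    where
    square : ℕ → ℤ
    square i = + suc i * + suc i
    suc<q : ∀ {i} → i ℕ.< half → suc i ℕ.< q
    suc<q i<half = ℕP.≤-<-trans i<half half<q
    roots : ∀ i → i ℕ.< half → q∣ eval x^[1+ h ]-1 (square i)
    roots i i<half = q∣-resp (sym (eval-x^[1+ h ]-1 (square i))) (un≈ (square^half (+ suc i) (unit-suc i (suc<q i<half))))
    -- (j+1)² ≡ (i+1)² forces q ∣ (j+1) − (i+1) or q ∣ (j+1) + (i+1), both excluded.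
    distinct : ∀ i j → j ℕ.< i → i ℕ.< half → ¬ square j ≈ square i
    distinct i j j<i i<half (mk≈ d) =
      [ (λ q∣diff → ℕP.<-irrefl (ℕP.suc-injective (residues-distinct (suc j) (suc i) (suc<q j<half) (suc<q i<half) q∣diff)) j<i)
      , (λ q∣sum → ℕP.1+n≢0 (q∣-small sum<q (q∣-resp (sym (ℤP.pos-+ (suc j) (suc i))) q∣sum))) ]′
      (q∣-product (+ suc j - + suc i) (+ suc j + + suc i) (q∣-resp (factor (+ suc j) (+ suc i)) d))
      where
      j<half : j ℕ.< half
      j<half = ℕP.<-trans j<i i<half
      factor : ∀ a b → a * a - b * b ≡ (a - b) * (a + b)
      factor = solve-∀
      sum<q : suc j ℕ.+ suc i ℕ.< q
      sum<q = ℕP.≤-<-trans (ℕP.+-mono-≤ j<half i<half) half+half<q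

  ±1-square-root : ∀ y → y * y ≈ + 1 → y ≈ + 1 ⊎ y ≈ - + 1
  ±1-square-root y (mk≈ d) = [ inj₁ ∘ mk≈ , inj₂ ∘ mk≈ ]′ (q∣-product (y - + 1) (y - - + 1) (q∣-resp (factor y) d))
    where
    factor : ∀ y → y * y - + 1 ≡ (y - + 1) * (y - - + 1)
    factor = solve-∀

  euler : ∀ x → legendre x q ≈ x ^ half
  euler x with q∣? x
  ... | yes q∣x = ≈-trans (≈-reflexive (legendre-zero x q∣x)) (≈-sym (q∣⇒≈0 (q∣-*ʳ (x ^ h) q∣x)))
  ... | no ¬q∣x with square? x
  ...   | yes (s , s²≈x) = ≈-trans (≈-reflexive (legendre-square x ¬q∣x (s , s²≈x)))
                                   (≈-sym (≈-trans (^-cong half (≈-sym s²≈x)) (square^half s ¬q∣s)))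
    where
    ¬q∣s : ¬ q∣ s
    ¬q∣s q∣s = ¬q∣x (q∣-resp-≈ (≈-sym s²≈x) (q∣-*ʳ s q∣s))
  ...   | no ¬sq = [ (λ x^half≈1 → ⊥-elim (nonsquare^half x ¬sq x^half≈1))
                   , (λ x^half≈-1 → ≈-trans (≈-reflexive (legendre-nonsquare x ¬q∣x ¬sq)) (≈-sym x^half≈-1)) ]′
                   (±1-square-root (x ^ half) (≈-trans (≈-reflexive (^half-^half x)) (fermat x ¬q∣x)))

  legendre-cong : ∀ {x y} → x ≈ y → legendre x q ≡ legendre y q
  legendre-cong {x} {y} e = trit-≈ (legendre-trit x) (legendre-trit y)
    (≈-trans (euler x) (≈-trans (^-cong half e) (≈-sym (euler y))))

  legendre-* : ∀ x y → legendre (x * y) q ≡ legendre x q * legendre y q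
  legendre-* x y = trit-≈ (legendre-trit (x * y)) (trit-* (legendre-trit x) (legendre-trit y))
    (≈-trans (euler (x * y)) (≈-trans (≈-reflexive (^-distribʳ-* x y half)) (≈-sym (*-cong (euler x) (euler y)))))

  legendre-cube : ∀ x → legendre (x * x * x) q ≡ legendre x q
  legendre-cube x = trans (legendre-* (x * x) x) (trans (cong (_* legendre x q) (legendre-* x x)) (trit-cube (legendre-trit x)))

  legendre-square-factor : ∀ s x → ¬ q∣ s → legendre (s * s * x) q ≡ legendre x q
  legendre-square-factor s x ¬q∣s = trans (legendre-* (s * s) x)
    (trans (cong (_* legendre x q) (legendre-square (s * s) (unit-* ¬q∣s ¬q∣s) (s , ≈-refl))) (ℤP.*-identityˡ _))

  -- Since x^half − 1 has at most half < q − 1 roots, some unit is a non-residue.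
  nonresidue : ∃ λ g → ¬ q∣ g × legendre g q ≡ - + 1
  nonresidue =
    let (g , ¬q∣g , g^half≉1) = non-root h h+2<q
    in g , ¬q∣g , legendre-nonsquare g ¬q∣g (λ (s , s²≈g) →
         g^half≉1 (≈-trans (^-cong half (≈-sym s²≈g)) (square^half s (λ q∣s → ¬q∣g (q∣-resp-≈ (≈-sym s²≈g) (q∣-*ʳ s q∣s))))))
    where
    h+2<q : suc (suc h) ℕ.< q
    h+2<q = ℕP.≤-<-trans (ℕ.s≤s (ℕP.m≤n+m (suc h) h)) half+half<q

  -- Σ_{r<q} (r/q) = 0: multiplying by a non-residue g permutes the residues and negates the sum.
  ∑legendre≡0 : ∑ℤ q (λ r → legendre (+ r) q) ≡ + 0
  ∑legendre≡0 = let (g , ¬q∣g , [g/q]≡-1) = nonresidue in x≡-x⇒x≡0 (begin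
    S                                        ≡⟨ ∑ℤ-permute (λ x → legendre x q) legendre-cong (g *_) (cancel ¬q∣g) ⟩
    ∑ℤ q (λ r → legendre (g * + r) q)        ≡⟨ ∑ℤ-cong q (λ r _ → trans (legendre-* g (+ r)) (cong (_* legendre (+ r) q) [g/q]≡-1)) ⟩
    ∑ℤ q (λ r → - + 1 * legendre (+ r) q)    ≡⟨ ∑ℤ-scale q (- + 1) (λ r → legendre (+ r) q) ⟩
    - + 1 * S                                ∎)
    where
    open ≡-Reasoning
    S : ℤ
    S = ∑ℤ q (λ r → legendre (+ r) q)
    x≡-x⇒x≡0 : ∀ {x} → x ≡ - + 1 * x → x ≡ + 0
    x≡-x⇒x≡0 {x} e = ℤP.*-cancelˡ-≡ (+ 2) x (+ 0) (trans (double x) (trans (cong (λ t → x + t) e) (vanish x)))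
      where
      double : ∀ x → + 2 * x ≡ x + x
      double = solve-∀
      vanish : ∀ x → x + - + 1 * x ≡ + 2 * + 0
      vanish = solve-∀

  -- x ↦ (a x)^(q−2) sends x to the inverse of a x when q ∤ x, and to 0 when q ∣ x;
  -- for a unit a it is injective modulo q.
  inverse-of-multiple : ℤ → ℤ → ℤ
  inverse-of-multiple a x = (a * x) ^ k

  inverse-of-multiple-inverse : ∀ a → ¬ q∣ a → ∀ x → ¬ q∣ x → a * x * inverse-of-multiple a x ≈ + 1
  inverse-of-multiple-inverse a ¬q∣a x ¬q∣x = fermat (a * x) (unit-* ¬q∣a ¬q∣x)

  inverse-of-multiple-zero : ∀ a x → q∣ x → q∣ inverse-of-multiple a x
  inverse-of-multiple-zero a x q∣x =
    q∣-resp (cong ((a * x) ^_) (sym k≡1+2h)) (q∣-*ʳ ((a * x) ^ (h ℕ.+ h)) (q∣-*ˡ a q∣x))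

  inverse-of-multiple-injective : ∀ a → ¬ q∣ a → ∀ {x y} → inverse-of-multiple a x ≈ inverse-of-multiple a y → x ≈ y
  inverse-of-multiple-injective a ¬q∣a {x} {y} e with q∣? x | q∣? y
  ... | yes q∣x | yes q∣y = ≈-trans (q∣⇒≈0 q∣x) (≈-sym (q∣⇒≈0 q∣y))
  ... | yes q∣x | no ¬q∣y = ⊥-elim (unit-factorʳ (a * y) (inverse-of-multiple-inverse a ¬q∣a y ¬q∣y)
                                                (q∣-resp-≈ (≈-sym e) (inverse-of-multiple-zero a x q∣x)))
  ... | no ¬q∣x | yes q∣y = ⊥-elim (unit-factorʳ (a * x) (inverse-of-multiple-inverse a ¬q∣a x ¬q∣x)
                                                (q∣-resp-≈ e (inverse-of-multiple-zero a y q∣y)))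
  ... | no ¬q∣x | no ¬q∣y = cancel ¬q∣a (cancel (unit-factorʳ (a * x) (σ-inverse x ¬q∣x)) (begin
      σ x * (a * x)   ≈⟨ ≈-reflexive (ℤP.*-comm (σ x) (a * x)) ⟩
      a * x * σ x     ≈⟨ σ-inverse x ¬q∣x ⟩
      + 1             ≈⟨ ≈-sym (σ-inverse y ¬q∣y) ⟩
      a * y * σ y     ≈⟨ *-cong (≈-refl {a * y}) (≈-sym e) ⟩
      a * y * σ x     ≈⟨ ≈-reflexive (ℤP.*-comm (a * y) (σ x)) ⟩
      σ x * (a * y)   ∎))
    where
    open import Relation.Binary.Reasoning.Setoid (CommutativeMonoid.setoid *-commutativeMonoid)
    σ : ℤ → ℤ
    σ = inverse-of-multiple a
    σ-inverse : ∀ x → ¬ q∣ x → a * x * σ x ≈ + 1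
    σ-inverse = inverse-of-multiple-inverse a ¬q∣a

module CubeRoots (k : ℕ) (q-prime : Prime (suc (suc k))) (t : ℕ) (q-1≡3t : suc k ≡ 3 ℕ.* suc t) where
  open PrimeModulus k q-prime

  -- A primitive cube root of unity: ω = g^((q−1)/3) for a unit g with ω ≢ 1.
  ω-data : ∃ λ ω → ω * ω * ω ≈ + 1 × ¬ ω ≈ + 1
  ω-data =
    let (g , ¬q∣g , g^t≉1) = non-root t t+2<q
    in g ^ suc t , ≈-trans (≈-reflexive (trans (^-cube g (suc t)) (cong (g ^_) (sym q-1≡3t)))) (fermat g ¬q∣g) , g^t≉1
    where
    t+2<q : suc (suc t) ℕ.< q
    t+2<q = ℕ.s≤s (ℕP.≤-trans t+2≤3[t+1] (ℕP.≤-reflexive (sym q-1≡3t)))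
      where
      t+2≤3[t+1] : suc (suc t) ℕ.≤ 3 ℕ.* suc t
      t+2≤3[t+1] = ℕ.s≤s (ℕP.≤-trans (ℕP.m≤n+m (suc t) t) (ℕP.+-monoʳ-≤ t (ℕP.m≤m+n (suc t) _)))

  ω : ℤ
  ω = proj₁ ω-data

  ω³≈1 : ω * ω * ω ≈ + 1
  ω³≈1 = proj₁ (proj₂ ω-data)

  ω≉1 : ¬ ω ≈ + 1
  ω≉1 = proj₂ (proj₂ ω-data)

  ω-unit : ¬ q∣ ω
  ω-unit q∣ω = ¬q∣1 (q∣-resp-≈ (≈-sym ω³≈1) (q∣-*ʳ ω (q∣-*ʳ ω q∣ω)))

  ω²-cube : (ω * ω) * (ω * ω) * (ω * ω) ≈ + 1
  ω²-cube = ≈-trans (≈-reflexive (regroup ω)) (*-cong ω³≈1 ω³≈1)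
    where
    regroup : ∀ w → (w * w) * (w * w) * (w * w) ≡ (w * w * w) * (w * w * w)
    regroup = solve-∀

  ω≉ω² : ¬ ω ≈ ω * ω
  ω≉ω² e = ω≉1 (≈-sym (cancel ω-unit (≈-trans (≈-reflexive (ℤP.*-identityʳ ω)) e)))

  1≉ω² : ¬ + 1 ≈ ω * ω
  1≉ω² e = ω≉1 (≈-trans (≈-reflexive (sym (ℤP.*-identityʳ ω)))
                (≈-trans (*-cong (≈-refl {ω}) e) (≈-trans (≈-reflexive (sym (ℤP.*-assoc ω ω ω))) ω³≈1)))

  -- The cube roots of unity are 1, ω, ω²: z³ − 1 = (z − 1)(z² + z + 1) and
  -- z² + z + 1 − (ω² + ω + 1) = (z − ω)(z + ω + 1), where ω² + ω + 1 ≡ 0.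
  cube-root-of-unity : ∀ z → z * z * z ≈ + 1 → z ≈ + 1 ⊎ z ≈ ω ⊎ z ≈ ω * ω
  cube-root-of-unity z (mk≈ d) = [ inj₁ ∘ mk≈ , inj₂ ∘ other-roots ]′ (q∣-product (z - + 1) (z * z + z + + 1) (q∣-resp (factor z) d))
    where
    factor : ∀ x → x * x * x - + 1 ≡ (x - + 1) * (x * x + x + + 1)
    factor = solve-∀
    ω²+ω+1≡0 : q∣ (ω * ω + ω + + 1)
    ω²+ω+1≡0 = [ (λ q∣ω-1 → ⊥-elim (ω≉1 (mk≈ q∣ω-1))) , (λ root → root) ]′
      (q∣-product (ω - + 1) (ω * ω + ω + + 1) (q∣-resp (factor ω) (un≈ ω³≈1)))
    factor′ : ∀ x w → (x - w) * (x - w * w) ≡ + 1 * (x * x + x + + 1) + (- x) * (w * w + w + + 1) + + 1 * (w * w * w - + 1)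
    factor′ = solve-∀
    other-roots : q∣ (z * z + z + + 1) → z ≈ ω ⊎ z ≈ ω * ω
    other-roots root = [ inj₁ ∘ mk≈ , inj₂ ∘ mk≈ ]′
      (q∣-product (z - ω) (z - ω * ω) (q∣-combination₃ _ (+ 1) (- z) (+ 1) (factor′ z ω) root ω²+ω+1≡0 (un≈ ω³≈1)))

  -- If q ∤ ab and a²b ≡ c³, then a x³ + b has exactly the three roots s, sω, sω²
  -- modulo q, where s = −c a⁻¹ (with a⁻¹ = a^(q−2)).
  module ResidueRoots (a b c : ℤ) (¬q∣a : ¬ q∣ a) (¬q∣b : ¬ q∣ b) (c³≈a²b : c * c * c ≈ a * a * b) where
    F : ℤ → ℤ
    F = cubicPoly a b
    F-cong : ∀ {x y} → x ≈ y → F x ≈ F y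
    F-cong e = +-cong (*-cong (≈-refl {a}) (cube-cong e)) (≈-refl {b})
    s : ℤ
    s = - c * a ^ k
    F[s]≈0 : q∣ F s
    F[s]≈0 = q∣-combination _ (- (a * (a ^ k * a ^ k * a ^ k))) (- b) (expand a b c (a ^ k))
                              (un≈ c³≈a²b) (un≈ (cube-cong (fermat a ¬q∣a)))
      where
      expand : ∀ a b c a⁻¹ → a * ((- c * a⁻¹) * (- c * a⁻¹) * (- c * a⁻¹)) + b
        ≡ (- (a * (a⁻¹ * a⁻¹ * a⁻¹))) * (c * c * c - a * a * b)
          + (- b) * ((a * a⁻¹) * (a * a⁻¹) * (a * a⁻¹) - + 1 * + 1 * + 1)
      expand = solve-∀
    s-unit : ¬ q∣ s
    s-unit q∣s = ¬q∣b (q∣-combination b (+ 1) (- (a * s * s)) (expand a b s) F[s]≈0 q∣s)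
      where
      expand : ∀ a b s → b ≡ + 1 * (a * (s * s * s) + b) + (- (a * s * s)) * s
      expand = solve-∀
    -- F(s z) = z³ F(s) − b (z³ − 1).
    F[sz]≈0 : ∀ z → z * z * z ≈ + 1 → q∣ F (s * z)
    F[sz]≈0 z z³≈1 = q∣-combination _ (z * z * z) (- b) (expand a b s z) F[s]≈0 (un≈ z³≈1)
      where
      expand : ∀ a b s z → a * ((s * z) * (s * z) * (s * z)) + b
                           ≡ (z * z * z) * (a * (s * s * s) + b) + (- b) * (z * z * z - + 1)
      expand = solve-∀
    roots-are : ∀ x → x ≈ s ⊎ x ≈ s * ω ⊎ x ≈ s * (ω * ω) → q∣ F x
    roots-are x = [ (λ e → q∣-resp-≈ (F-cong (≈-trans e (≈-reflexive (sym (ℤP.*-identityʳ s))))) (F[sz]≈0 (+ 1) ≈-refl))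
                  , [ (λ e → q∣-resp-≈ (F-cong e) (F[sz]≈0 ω ω³≈1)) , (λ e → q∣-resp-≈ (F-cong e) (F[sz]≈0 (ω * ω) ω²-cube)) ]′ ]′
    -- A root x has x³ ≡ s³, so z = x s⁻¹ is a cube root of unity and x ≡ s z.
    roots-only : ∀ x → q∣ F x → x ≈ s ⊎ x ≈ s * ω ⊎ x ≈ s * (ω * ω)
    roots-only x F[x]≈0 = [ (λ z≈1 → inj₁ (≈-trans (x≈sz z≈1) (≈-reflexive (ℤP.*-identityʳ s))))
                          , [ inj₂ ∘ inj₁ ∘ x≈sz , inj₂ ∘ inj₂ ∘ x≈sz ]′ ]′ (cube-root-of-unity z z³≈1)
      where
      difference : ∀ a b x s → a * (x * x * x) - a * (s * s * s) ≡ + 1 * (a * (x * x * x) + b) + - + 1 * (a * (s * s * s) + b)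
      difference = solve-∀
      x³≈s³ : x * x * x ≈ s * s * s
      x³≈s³ = cancel ¬q∣a (mk≈ (q∣-combination _ (+ 1) (- + 1) (difference a b x s) F[x]≈0 F[s]≈0))
      z : ℤ
      z = x * s ^ k
      z³≈1 : z * z * z ≈ + 1
      z³≈1 = ≈-trans (≈-reflexive (regroup x (s ^ k))) (≈-trans (*-cong x³≈s³ (≈-refl {s ^ k * s ^ k * s ^ k}))
               (≈-trans (≈-reflexive (regroup′ s (s ^ k))) (cube-cong (fermat s s-unit))))
        where
        regroup : ∀ x y → (x * y) * (x * y) * (x * y) ≡ (x * x * x) * (y * y * y)
        regroup = solve-∀
        regroup′ : ∀ x y → (x * x * x) * (y * y * y) ≡ (x * y) * (x * y) * (x * y)
        regroup′ = solve-∀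
      x≈sz : ∀ {w} → z ≈ w → x ≈ s * w
      x≈sz {w} z≈w = ≈-trans (≈-sym (≈-trans (≈-reflexive (swap s x (s ^ k)))
                       (≈-trans (*-cong (≈-refl {x}) (fermat s s-unit)) (≈-reflexive (ℤP.*-identityʳ x)))))
                       (*-cong (≈-refl {s}) z≈w)
        where
        swap : ∀ s x y → s * (x * y) ≡ x * (s * y)
        swap = solve-∀
    s≉sω : ¬ s ≈ s * ω
    s≉sω e = ω≉1 (≈-sym (cancel s-unit (≈-trans (≈-reflexive (ℤP.*-identityʳ s)) e)))
    s≉sω² : ¬ s ≈ s * (ω * ω)
    s≉sω² e = 1≉ω² (cancel s-unit (≈-trans (≈-reflexive (ℤP.*-identityʳ s)) e))
    sω≉sω² : ¬ s * ω ≈ s * (ω * ω)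
    sω≉sω² e = ω≉ω² (cancel s-unit e)

  unitCount-cubic-residue : ∀ a b c → ¬ q∣ a → ¬ q∣ b → c * c * c ≈ a * a * b → unitCount (cubicPoly a b) ≡ q ∸ 3
  unitCount-cubic-residue a b c ¬q∣a ¬q∣b c³≈a²b =
    unitCount-three-roots F s (s * ω) (s * (ω * ω)) s≉sω s≉sω² sω≉sω² roots-only roots-are
    where open ResidueRoots a b c ¬q∣a ¬q∣b c³≈a²b

module CubicCharacterSum (k : ℕ) (q-prime : Prime (suc (suc k))) (h : ℕ) (q-1≡2h : suc k ≡ suc h ℕ.+ suc h) where
  open OddPrime k q-prime h q-1≡2h

  -- Σ_{r mod q} (F(r)/q), the numerator of a_q(F); thus aq F q = divℚ (characterSum F) (unitCount F).
  characterSum : (ℤ → ℤ) → ℤ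
  characterSum F = sumℤ (map (λ r → legendre (F (+ r)) q) (upTo q))

  characterSum-∑ : ∀ F → characterSum F ≡ ∑ℤ q (λ r → legendre (F (+ r)) q)
  characterSum-∑ F = sumℤ-upTo q (λ r → legendre (F (+ r)) q)

  -- If q ∣ a then f ≡ b, so a_q(f) = q (b/q) / q.
  aq-q∣a : ∀ a b → gcd a b ≡ + 1 → q∣ a → aq (cubicPoly a b) q ≡ legendre b q / 1
  aq-q∣a a b gcd≡1 q∣a = trans (cong₂ divℚ sum≡ count≡) (multiple/n q (legendre b q))
    where
    ¬q∣b : ¬ q∣ b
    ¬q∣b q∣b = ℕP.<-irrefl refl (ℕP.≤-<-trans
      (ℕD.∣⇒≤ (subst (q ℕD.∣_) (ℤP.+-injective gcd≡1) (ℕGCD.gcd-greatest (Signed.∣⇒∣ᵤ q∣a) (Signed.∣⇒∣ᵤ q∣b)))) 1<q)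
    f≈b : ∀ x → cubicPoly a b x ≈ b
    f≈b x = mk≈ (q∣-multiple _ (x * x * x) (difference a b x) q∣a)
      where
      difference : ∀ a b x → a * (x * x * x) + b - b ≡ (x * x * x) * a
      difference = solve-∀
    sum≡ : characterSum (cubicPoly a b) ≡ + q * legendre b q
    sum≡ = trans (characterSum-∑ (cubicPoly a b)) (trans (∑ℤ-cong q (λ r _ → legendre-cong (f≈b (+ r)))) (∑ℤ-const q (legendre b q)))
    count≡ : unitCount (cubicPoly a b) ≡ q
    count≡ = unitCount-all (cubicPoly a b) (λ r _ q∣f → ¬q∣b (q∣-resp-≈ (≈-sym (f≈b (+ r))) q∣f))

  -- If q ∣ b then (a r³ / q) = (a/q)(r/q), and Σ_r (r/q) = 0.
  characterSum-q∣b : ∀ a b → q∣ b → characterSum (cubicPoly a b) ≡ + 0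
  characterSum-q∣b a b q∣b = begin
    characterSum (cubicPoly a b)                          ≡⟨ characterSum-∑ (cubicPoly a b) ⟩
    ∑ℤ q (λ r → legendre (cubicPoly a b (+ r)) q)         ≡⟨ ∑ℤ-cong q (λ r _ → term (+ r)) ⟩
    ∑ℤ q (λ r → legendre a q * legendre (+ r) q)          ≡⟨ ∑ℤ-scale q (legendre a q) (λ r → legendre (+ r) q) ⟩
    legendre a q * ∑ℤ q (λ r → legendre (+ r) q)          ≡⟨ cong (legendre a q *_) ∑legendre≡0 ⟩
    legendre a q * + 0                                    ≡⟨ ℤP.*-zeroʳ (legendre a q) ⟩
    + 0                                                   ∎
    where
    open ≡-Reasoning
    difference : ∀ a b x → a * (x * x * x) + b - a * (x * x * x) ≡ + 1 * b
    difference = solve-∀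
    term : ∀ x → legendre (cubicPoly a b x) q ≡ legendre a q * legendre x q
    term x = trans (legendre-cong {cubicPoly a b x} {a * (x * x * x)} (mk≈ (q∣-multiple (cubicPoly a b x - a * (x * x * x)) (+ 1) (difference a b x) q∣b)))
                   (trans (legendre-* a (x * x * x)) (cong (legendre a q *_) (legendre-cube x)))

  -- If cubing is injective mod q and q ∤ a, the substitutions r ↦ r³ and
  -- r ↦ a r + b permute the residues, so the sum equals Σ_r (r/q) = 0.
  characterSum-cube-injective : ∀ a b → ¬ q∣ a → (∀ {x y} → x * x * x ≈ y * y * y → x ≈ y) →
                                characterSum (cubicPoly a b) ≡ + 0
  characterSum-cube-injective a b ¬q∣a cube-inj = begin
    characterSum (cubicPoly a b)                ≡⟨ characterSum-∑ (cubicPoly a b) ⟩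
    ∑ℤ q (λ r → legendre (affine (+ r * + r * + r)) q)
      ≡⟨ sym (∑ℤ-permute (λ x → legendre (affine x) q) (legendre-cong ∘ affine-cong) (λ x → x * x * x) cube-inj) ⟩
    ∑ℤ q (λ r → legendre (affine (+ r)) q)
      ≡⟨ sym (∑ℤ-permute (λ x → legendre x q) legendre-cong affine affine-inj) ⟩
    ∑ℤ q (λ r → legendre (+ r) q)               ≡⟨ ∑legendre≡0 ⟩
    + 0                                         ∎
    where
    open ≡-Reasoning
    affine : ℤ → ℤ
    affine x = a * x + b
    affine-cong : ∀ {x y} → x ≈ y → affine x ≈ affine y
    affine-cong e = +-cong (*-cong (≈-refl {a}) e) (≈-refl {b})
    difference : ∀ a b x y → (a * x + b) - (a * y + b) ≡ a * x - a * y
    difference = solve-∀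
    affine-inj : ∀ {x y} → affine x ≈ affine y → x ≈ y
    affine-inj {x} {y} (mk≈ d) = cancel ¬q∣a (mk≈ (q∣-resp (difference a b x y) d))

  -- The substitution u = (a r)⁻¹ for q ∤ ab, where a ā ≡ b b̄ ≡ 1 mod q.
  module Substitution (a b ā b̄ : ℤ) (¬q∣a : ¬ q∣ a) (¬q∣b : ¬ q∣ b) (aā≈1 : a * ā ≈ + 1) (bb̄≈1 : b * b̄ ≈ + 1) where
    F : ℤ → ℤ
    F = cubicPoly a b
    E : ℤ
    E = ā * ā * b̄
    L : ℤ → ℤ
    L x = legendre x q
    Φ : ℤ → ℤ
    Φ u = L u * L (u * u * u + E)
    Φ-cong : ∀ {x y} → x ≈ y → Φ x ≡ Φ y
    Φ-cong e = cong₂ _*_ (legendre-cong e) (legendre-cong (+-cong (cube-cong e) (≈-refl {E})))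
    ∑Φ≡phi3 : ∑ℤ q (λ r → Φ (+ r)) ≡ phi3 q E
    ∑Φ≡phi3 = trans (cong (_+ ∑ℤ (suc k) (λ u → Φ (+ suc u))) Φ0≡0)
                    (trans (ℤP.+-identityˡ _) (sym (sumℤ-upTo (suc k) (λ u → Φ (+ suc u)))))
      where
      Φ0≡0 : Φ (+ 0) ≡ + 0
      Φ0≡0 = trans (cong (_* L (+ 0 * + 0 * + 0 + E)) (legendre-zero (+ 0) q∣0)) (ℤP.*-zeroˡ (L (+ 0 * + 0 * + 0 + E)))
    key : ∀ r u → a * r * u ≈ + 1 → b * u * (u * u * u + E) ≈ (u * u) * (u * u) * F r
    key r u aru≈1 = mk≈ (q∣-combination₃ _ (ā * ā * u) (- (ā * ā * u)) (a * (r * r * r) * (u * u * u * u))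
                          (expand a b r u ā b̄) (un≈ bb̄≈1) (un≈ (cube-cong aru≈1)) (un≈ (*-cong aā≈1 aā≈1)))
      where
      expand : ∀ a b r u ā b̄ → b * u * (u * u * u + ā * ā * b̄) - (u * u) * (u * u) * (a * (r * r * r) + b)
        ≡ (ā * ā * u) * (b * b̄ - + 1) + (- (ā * ā * u)) * ((a * r * u) * (a * r * u) * (a * r * u) - + 1 * + 1 * + 1)
          + (a * (r * r * r) * (u * u * u * u)) * ((a * ā) * (a * ā) - + 1 * + 1)
      expand = solve-∀
    -- Hence (b/q) Φ(u) = (f(r)/q), the square u² dropping out.
    key-legendre : ∀ r u → a * r * u ≈ + 1 → L b * Φ u ≡ L (F r)
    key-legendre r u aru≈1 = begin
      L b * (L u * L (u * u * u + E))     ≡⟨ sym (ℤP.*-assoc (L b) (L u) _) ⟩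
      L b * L u * L (u * u * u + E)       ≡⟨ cong (_* L (u * u * u + E)) (sym (legendre-* b u)) ⟩
      L (b * u) * L (u * u * u + E)       ≡⟨ sym (legendre-* (b * u) (u * u * u + E)) ⟩
      L (b * u * (u * u * u + E))         ≡⟨ legendre-cong (key r u aru≈1) ⟩
      L ((u * u) * (u * u) * F r)         ≡⟨ legendre-square-factor (u * u) (F r) (unit-* ¬q∣u ¬q∣u) ⟩
      L (F r)                             ∎
      where
      open ≡-Reasoning
      ¬q∣u : ¬ q∣ u
      ¬q∣u = unit-factorʳ (a * r) aru≈1
    σ : ℤ → ℤ
    σ = inverse-of-multiple a
    σ-inverse : ∀ x → ¬ q∣ x → a * x * σ x ≈ + 1
    σ-inverse = inverse-of-multiple-inverse a ¬q∣a
    σ-zero : ∀ x → q∣ x → q∣ σ x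
    σ-zero = inverse-of-multiple-zero a
    σ-inj : ∀ {x y} → σ x ≈ σ y → x ≈ y
    σ-inj = inverse-of-multiple-injective a ¬q∣a
    term₀ : L b * Φ (σ (+ 0)) ≡ + 0
    term₀ = trans (cong (λ z → L b * (z * L (σ (+ 0) * σ (+ 0) * σ (+ 0) + E))) (legendre-zero (σ (+ 0)) (σ-zero (+ 0) q∣0)))
                  (trans (cong (L b *_) (ℤP.*-zeroˡ (L (σ (+ 0) * σ (+ 0) * σ (+ 0) + E)))) (ℤP.*-zeroʳ (L b)))
    term : ∀ x → ¬ q∣ x → L b * Φ (σ x) ≡ L (F x)
    term x ¬q∣x = key-legendre x (σ x) (σ-inverse x ¬q∣x)

  characterSum-substitution : ∀ a b ā b̄ → ¬ q∣ a → ¬ q∣ b → a * ā ≈ + 1 → b * b̄ ≈ + 1 →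
    characterSum (cubicPoly a b) ≡ legendre b q * (+ 1 + phi3 q (ā * ā * b̄))
  characterSum-substitution a b ā b̄ ¬q∣a ¬q∣b aā≈1 bb̄≈1 = begin
    characterSum F
      ≡⟨ characterSum-∑ F ⟩
    L (F (+ 0)) + ∑ℤ (suc k) (λ r → L (F (+ suc r)))
      ≡⟨ cong₂ _+_ (cong L (F0≡b a b)) (∑ℤ-cong (suc k) (λ r r<k → sym (term (+ suc r) (unit-suc r (ℕ.s≤s r<k))))) ⟩
    L b + ∑ℤ (suc k) (λ r → L b * Φ (σ (+ suc r)))
      ≡⟨ cong (λ z → L b + z) (sym (trans (cong (_+ ∑ℤ (suc k) (λ r → L b * Φ (σ (+ suc r)))) term₀)
                                          (ℤP.+-identityˡ _))) ⟩
    L b + ∑ℤ q (λ r → L b * Φ (σ (+ r)))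
      ≡⟨ cong (λ z → L b + z) (sym (∑ℤ-permute (λ x → L b * Φ x) (cong (L b *_) ∘ Φ-cong) σ σ-inj)) ⟩
    L b + ∑ℤ q (λ r → L b * Φ (+ r))
      ≡⟨ cong (λ z → L b + z) (∑ℤ-scale q (L b) (λ r → Φ (+ r))) ⟩
    L b + L b * ∑ℤ q (λ r → Φ (+ r))
      ≡⟨ cong (λ z → L b + L b * z) ∑Φ≡phi3 ⟩
    L b + L b * phi3 q E
      ≡⟨ cong (_+ L b * phi3 q E) (sym (ℤP.*-identityʳ (L b))) ⟩
    L b * + 1 + L b * phi3 q E
      ≡⟨ sym (ℤP.*-distribˡ-+ (L b) (+ 1) (phi3 q E)) ⟩
    L b * (+ 1 + phi3 q E)
      ∎
    where
    open Substitution a b ā b̄ ¬q∣a ¬q∣b aā≈1 bb̄≈1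
    open ≡-Reasoning
    F0≡b : ∀ a b → a * (+ 0 * + 0 * + 0) + b ≡ b
    F0≡b = solve-∀

  -- If a² b is not a cube mod q, then f has no root: q ∣ f(r) would give
  -- (−a r)³ − a² b = −a² f(r) ≡ 0.
  unitCount-cubic-nonresidue : ∀ a b → ¬ q∣ a → ¬ q∣ b → ¬ CubicResidue (a * a * b) q → unitCount (cubicPoly a b) ≡ q
  unitCount-cubic-nonresidue a b ¬q∣a ¬q∣b ¬cube = unitCount-all (cubicPoly a b) λ r _ q∣f →
    ¬cube (unit⇒gcd≡1 (a * a * b) (unit-* (unit-* ¬q∣a ¬q∣a) ¬q∣b) , - a * + r ,
           Signed.∣⇒∣ᵤ (q∣-multiple _ (- (a * a)) (expand a b (+ r)) q∣f))
    where
    expand : ∀ a b x → (- a * x) * (- a * x) * (- a * x) - a * a * b ≡ (- (a * a)) * (a * (x * x * x) + b)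
    expand = solve-∀

  units-of-product : ∀ a b → ¬ (+ q ∣ a * b) → ¬ q∣ a × ¬ q∣ b
  units-of-product a b q∤ab = (λ q∣a → q∤ab (Signed.∣⇒∣ᵤ (q∣-*ʳ b q∣a))) , (λ q∣b → q∤ab (Signed.∣⇒∣ᵤ (q∣-*ˡ a q∣b)))

  case-q∣a : ∀ a b → gcd a b ≡ + 1 → + q ∣ a → aq (cubicPoly a b) q ≡ legendre b q / 1
  case-q∣a a b gcd≡1 q∣a = aq-q∣a a b gcd≡1 (Signed.∣ᵤ⇒∣ q∣a)

  case-vanishing : ∀ a b → ¬ (+ q ∣ a) → (+ q ∣ b) ⊎ (q ≡ 3) ⊎ (q % 3 ≡ 2) → aq (cubicPoly a b) q ≡ 0ℚ
  case-vanishing a b q∤a cases =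
    trans (cong (λ S → divℚ S (unitCount (cubicPoly a b))) (vanishes cases)) (divℚ-zero (unitCount (cubicPoly a b)))
    where
    ¬q∣a : ¬ q∣ a
    ¬q∣a = q∤a ∘ Signed.∣⇒∣ᵤ
    vanishes : (+ q ∣ b) ⊎ (q ≡ 3) ⊎ (q % 3 ≡ 2) → characterSum (cubicPoly a b) ≡ + 0
    vanishes (inj₁ q∣b) = characterSum-q∣b a b (Signed.∣ᵤ⇒∣ q∣b)
    vanishes (inj₂ q≢1[3]) =
      let (e , m , 3e≡) = cubing-exponent k q≢1[3]
      in characterSum-cube-injective a b ¬q∣a (cube-injective e m 3e≡)

  case-cubic-residue : ∀ a b → ¬ (+ q ∣ a * b) → q % 3 ≡ 1 → CubicResidue (a * a * b) q →
    (ā b̄ : ℤ) → (a * ā ≡ᶻ + 1 [mod q ]) → (b * b̄ ≡ᶻ + 1 [mod q ]) →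
    aq (cubicPoly a b) q ≡ divℚ (legendre b q * (+ 1 + phi3 q (ā * ā * b̄))) (q ∸ 3)
  case-cubic-residue a b q∤ab q≡1[3] (_ , c , c³≡a²b) ā b̄ aā≡1 bb̄≡1 =
    let (¬q∣a , ¬q∣b) = units-of-product a b q∤ab
        (t , q-1≡3t) = q≡1[3]⇒ k q≡1[3]
    in cong₂ divℚ (characterSum-substitution a b ā b̄ ¬q∣a ¬q∣b (mk≈ (Signed.∣ᵤ⇒∣ aā≡1)) (mk≈ (Signed.∣ᵤ⇒∣ bb̄≡1)))
                  (CubeRoots.unitCount-cubic-residue k q-prime t q-1≡3t a b c ¬q∣a ¬q∣b (mk≈ (Signed.∣ᵤ⇒∣ c³≡a²b)))

  case-cubic-nonresidue : ∀ a b → ¬ (+ q ∣ a * b) → q % 3 ≡ 1 → ¬ CubicResidue (a * a * b) q →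
    (ā b̄ : ℤ) → (a * ā ≡ᶻ + 1 [mod q ]) → (b * b̄ ≡ᶻ + 1 [mod q ]) →
    aq (cubicPoly a b) q ≡ divℚ (legendre b q * (+ 1 + phi3 q (ā * ā * b̄))) q
  case-cubic-nonresidue a b q∤ab _ ¬cube ā b̄ aā≡1 bb̄≡1 =
    let (¬q∣a , ¬q∣b) = units-of-product a b q∤ab
    in cong₂ divℚ (characterSum-substitution a b ā b̄ ¬q∣a ¬q∣b (mk≈ (Signed.∣ᵤ⇒∣ aā≡1)) (mk≈ (Signed.∣ᵤ⇒∣ bb̄≡1)))
                  (unitCount-cubic-nonresidue a b ¬q∣a ¬q∣b ¬cube)

lemma5p3 : (a b : ℤ) (q : ℕ) → gcd a b ≡ + 1 → Prime q → q ≢ 2 →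
    ((+ q ∣ a) → aq (cubicPoly a b) q ≡ legendre b q / 1)
    × (¬ (+ q ∣ a) → ((+ q ∣ b) ⊎ (q ≡ 3) ⊎ (q % 3 ≡ 2)) → aq (cubicPoly a b) q ≡ 0ℚ)
    × (¬ (+ q ∣ a * b) → q % 3 ≡ 1 → CubicResidue (a * a * b) q →
        (abar bbar : ℤ) → (a * abar ≡ᶻ + 1 [mod q ]) → (b * bbar ≡ᶻ + 1 [mod q ]) →
        aq (cubicPoly a b) q
          ≡ divℚ (legendre b q * (+ 1 + phi3 q (abar * abar * bbar))) (q ∸ 3))
    × (¬ (+ q ∣ a * b) → q % 3 ≡ 1 → ¬ CubicResidue (a * a * b) q →
        (abar bbar : ℤ) → (a * abar ≡ᶻ + 1 [mod q ]) → (b * bbar ≡ᶻ + 1 [mod q ]) →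
        aq (cubicPoly a b) q
          ≡ divℚ (legendre b q * (+ 1 + phi3 q (abar * abar * bbar))) q)
lemma5p3 a b zero _ q-prime _ = ⊥-elim (¬prime[0] q-prime)
lemma5p3 a b (suc zero) _ q-prime _ = ⊥-elim (¬prime[1] q-prime)
lemma5p3 a b (suc (suc k)) gcd≡1 q-prime q≢2 =
  S.case-q∣a a b gcd≡1 , S.case-vanishing a b , S.case-cubic-residue a b , S.case-cubic-nonresidue a b
  where
  module S = CubicCharacterSum k q-prime (proj₁ (odd-prime-half k q-prime q≢2)) (proj₂ (odd-prime-half k q-prime q≢2))
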